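{- For every positive integer $n$, $$\mathrm{SgnDAltrun}_{n,-,a}(p,q)=\begin{cases}(1-q)(1-pq)^{k-1}& n=2k,\\ (1-pq)^k & n=2k+1,\end{cases}\qquad \mathrm{SgnDAltrun}_{n,-,d}(p,q)=\begin{cases}(1-p)(1-pq)^{k-1}& n=2k,\\ 0 & n\text{ odd}.\end{cases}$$
   Context: $\mathfrak{B}_n$ is the group of signed permutations in window notation $\pi=\pi_1\cdots\pi_n$ ($\pi_i\in\{\pm1,\dots,\pm n\}$, $\{|\pi_i|\}=[n]$), and $\mathfrak{D}_n\subseteq\mathfrak{B}_n$ is the subset of those with an even number of negative entries. For $\pi\in\mathfrak{B}_n$, $\mathrm{inv}_D(\pi)=|\{1\le i<j\le n:\pi_i>\pi_j\}|+|\{1\le i<j\le n:-\pi_i>\pi_j\}|$ (usual order on $\mathbb{Z}$). Set $\pi_0=0$; $\mathrm{pk}_D(\pi)$ (resp. $\mathrm{val}_D(\pi)$) is the number of $i\in\{1,\dots,n-1\}$ with $\pi_{i-1}<\pi_i>\pi_{i+1}$ (resp. $\pi_{i-1}>\pi_i<\pi_{i+1}$). Let $\mathfrak{D}_{n,-,a}=\{\pi\in\mathfrak{D}_n:\pi_{n-1}<\pi_n\}$, $\mathfrak{D}_{n,-,d}=\{\pi\in\mathfrak{D}_n:\pi_{n-1}>\pi_n\}$, and $\mathrm{SgnDAltrun}_{n,-,a}(p,q)=\sum_{\pi\in\mathfrak{D}_{n,-,a}}(-1)^{\mathrm{inv}_D(\pi)}p^{\mathrm{pk}_D(\pi)}q^{\mathrm{val}_D(\pi)}$,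 and similarly $\mathrm{SgnDAltrun}_{n,-,d}$ over $\mathfrak{D}_{n,-,d}$. -}

module Defs where

open import Level using (Level)
open import Data.Bool using (Bool; true; false; _∧_; _∨_; not; if_then_else_)
open import Data.Nat as ℕ using (ℕ; zero; suc)
open import Data.Integer as ℤ using (ℤ; +_; -[1+_]; ∣_∣)
open import Data.List using (List; []; _∷_; _++_; map; concatMap; upTo; filter; foldr)
open import Relation.Nullary.Decidable using (⌊_⌋)
open import Relation.Binary.PropositionalEquality using (_≡_)
open import Data.Bool.Properties using () renaming (_≟_ to _≟ᵇ_)
open import Algebra.Bundles using (CommutativeRing)

_<ᵇ_ : ℤ → ℤ → Bool
infix 4 _<ᵇ_
x <ᵇ y = ⌊ x ℤ.<? y ⌋

letters : ℕ → List ℤ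
letters n = map (λ i → + suc i) (upTo n) ++ map (λ i → -[1+ i ]) (upTo n)

words : ℕ → ℕ → List (List ℤ)
words zero    n = [] ∷ []
words (suc k) n = concatMap (λ w → map (_∷ w) (letters n)) (words k n)

notIn : ℕ → List ℕ → Bool
notIn m []       = true
notIn m (x ∷ xs) = not ⌊ m ℕ.≟ x ⌋ ∧ notIn m xs

distinct : List ℕ → Bool
distinct []       = true
distinct (x ∷ xs) = notIn x xs ∧ distinct xs

negCount : List ℤ → ℕ
negCount []       = 0
negCount (x ∷ xs) = (if x <ᵇ (+ 0) then 1 else 0) ℕ.+ negCount xs

isEven : ℕ → Bool
isEven zero          = true
isEven (suc zero)    = false
isEven (suc (suc n)) = isEven n

-- A word π of length n over ±[n] is a signed permutation (window notation)
-- iff the absolute values |π_i| are pairwise distinct (hence form [n]).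
-- 𝔇_n : signed permutations with an even number of negative entries.
isD : List ℤ → Bool
isD w = distinct (map ∣_∣ w) ∧ isEven (negCount w)

Dn : ℕ → List (List ℤ)
Dn n = filter (λ w → isD w ≟ᵇ true) (words n n)

countB : {A : Set} → (A → Bool) → List A → ℕ
countB P []       = 0
countB P (x ∷ xs) = (if P x then 1 else 0) ℕ.+ countB P xs

invD : List ℤ → ℕ
invD []       = 0
invD (x ∷ xs) = countB (λ y → y <ᵇ x) xs ℕ.+ countB (λ y → y <ᵇ ℤ.- x) xs ℕ.+ invD xs

-- peaks / valleys of the sequence π_0 π_1 ⋯ π_n (with π_0 = 0), i.e. indices
-- i ∈ {1, …, n-1}: these are exactly the middle entries of consecutive triples
pkList : List ℤ → ℕ
pkList (a ∷ b ∷ c ∷ xs) = (if (a <ᵇ b) ∧ (c <ᵇ b) then 1 else 0) ℕ.+ pkList (b ∷ c ∷ xs)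
pkList _                = 0

valList : List ℤ → ℕ
valList (a ∷ b ∷ c ∷ xs) = (if (b <ᵇ a) ∧ (b <ᵇ c) then 1 else 0) ℕ.+ valList (b ∷ c ∷ xs)
valList _                = 0

pkD : List ℤ → ℕ
pkD w = pkList (+ 0 ∷ w)

valD : List ℤ → ℕ
valD w = valList (+ 0 ∷ w)

lastAsc : List ℤ → Bool
lastAsc (a ∷ b ∷ []) = a <ᵇ b
lastAsc (a ∷ b ∷ c ∷ xs) = lastAsc (b ∷ c ∷ xs)
lastAsc _ = false

lastDes : List ℤ → Bool
lastDes (a ∷ b ∷ []) = b <ᵇ a
lastDes (a ∷ b ∷ c ∷ xs) = lastDes (b ∷ c ∷ xs)
lastDes _ = false

Dn-a : ℕ → List (List ℤ)
Dn-a n = filter (λ w → lastAsc (+ 0 ∷ w) ≟ᵇ true) (Dn n)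

Dn-d : ℕ → List (List ℤ)
Dn-d n = filter (λ w → lastDes (+ 0 ∷ w) ≟ᵇ true) (Dn n)

-- Polynomial identities in p, q with integer coefficients are stated as
-- identities valid in every commutative ring for all values of p, q.
module RingEval {c ℓ : Level} (R : CommutativeRing c ℓ) where
  open CommutativeRing R

  pow : Carrier → ℕ → Carrier
  pow x zero    = 1#
  pow x (suc k) = x * pow x k

  sgn : ℕ → Carrier
  sgn m = if isEven m then 1# else - 1#

  weight : Carrier → Carrier → List ℤ → Carrier
  weight p q w = sgn (invD w) * (pow p (pkD w) * pow q (valD w))

  sumW : Carrier → Carrier → List (List ℤ) → Carrier
  sumW p q = foldr (λ w acc → weight p q w + acc) 0#

  SgnDAltrun-a : ℕ → Carrier → Carrier → Carrier
  SgnDAltrun-a n p q = sumW p q (Dn-a n)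

  SgnDAltrun-d : ℕ → Carrier → Carrier → Carrier
  SgnDAltrun-d n p q = sumW p q (Dn-d n)

  oneMinus : Carrier → Carrier
  oneMinus x = 1# + (- x)

-- Build the signed permutation one letter at a time. For a prefix ending in the letters y, x,
-- consider the signed weight summed over all admissible completions. It depends on the prefix
-- only through the slope of the step y → x, the parity of the number of negative letters used,
-- and the position of x relative to ±v₀ and ±v₁, the two smallest unused absolute values: it is
-- a coefficient of a two-state transfer recursion (in the slope) when x lies in a window next
-- to ±v₀, and 0 otherwise. This is proved by induction on the number of letters still to place:
-- a new letter l contributes the sign (−1)^(rank of |l| among the unused values), and in the
-- expansion over l all terms cancel except those with |l| ∈ {v₀, v₁}. At the start (π₀ = 0,
-- nothing used) the window condition holds; two steps of the transfer recursion multiply by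
-- 1 − pq, which gives the closed forms, and the descent coefficients are the ascent ones with
-- p and q exchanged.

module Submission where

open import Defs
open import Level using (Level)
open import Data.Bool using (Bool; true; false; _∧_; _∨_; not; if_then_else_)
open import Data.Bool.Properties using (∧-zeroʳ; ∧-identityʳ; ∨-zeroʳ; ∧-commutativeMonoid) renaming (_≟_ to _≟ᵇ_)
open import Data.Nat as ℕ using (ℕ; zero; suc; _≤_; _<_; z≤n; s≤s)
import Data.Nat.Properties as ℕₚ
open import Data.Integer as ℤ using (ℤ; +_; -[1+_]; ∣_∣)
import Data.Integer.Properties as ℤₚ
open import Data.List using (List; []; _∷_; _++_; map; length; concat; concatMap; applyUpTo; upTo; foldr; filter)
open import Data.List.Properties using (length-map)
open import Data.List.Relation.Unary.All as All using (All; []; _∷_)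
open import Data.List.Relation.Unary.AllPairs using (AllPairs; []; _∷_)
open import Data.Product using (_×_; _,_; proj₁; proj₂)
open import Data.Empty using (⊥-elim)
open import Relation.Nullary using (¬_; Dec; yes; no)
open import Relation.Nullary.Decidable using (⌊_⌋; isYes≗does; dec-true; dec-false; does-⇔)
open import Function.Bundles using (mk⇔)
open import Relation.Binary using (tri<; tri≈; tri>)
open import Relation.Binary.PropositionalEquality as ≡ using (_≡_; _≢_)
open import Algebra.Bundles using (CommutativeRing; CommutativeMonoid)
open import Function using (_∘_)
import Algebra.Properties.CommutativeSemigroup as CommSemigroupProps
module ℕ+ = CommSemigroupProps ℕₚ.+-commutativeSemigroup
module ∧ = CommSemigroupProps (CommutativeMonoid.commutativeSemigroup ∧-commutativeMonoid)

module _ {a} {A : Set a} where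

  ⌊⌋-true : (a? : Dec A) → A → ⌊ a? ⌋ ≡ true
  ⌊⌋-true a? a = ≡.trans (isYes≗does a?) (dec-true a? a)

  ⌊⌋-false : (a? : Dec A) → ¬ A → ⌊ a? ⌋ ≡ false
  ⌊⌋-false a? ¬a = ≡.trans (isYes≗does a?) (dec-false a? ¬a)

  ⌊⌋-sound : (a? : Dec A) → ⌊ a? ⌋ ≡ true → A
  ⌊⌋-sound (yes a) _ = a

⌊⌋-⇔ : ∀ {a b} {A : Set a} {B : Set b} (a? : Dec A) (b? : Dec B) → (A → B) → (B → A) → ⌊ a? ⌋ ≡ ⌊ b? ⌋
⌊⌋-⇔ a? b? f g = ≡.trans (isYes≗does a?) (≡.trans (does-⇔ (mk⇔ f g) a? b?) (≡.sym (isYes≗does b?)))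

true≢false : true ≢ false
true≢false ()

∧-trueˡ : ∀ {a b} → (a ∧ b) ≡ true → a ≡ true
∧-trueˡ {true} _ = ≡.refl

∧-trueʳ : ∀ {a b} → (a ∧ b) ≡ true → b ≡ true
∧-trueʳ {true} h = h

module _ {x y : ℤ} where

  <ᵇ-true : x ℤ.< y → (x <ᵇ y) ≡ true
  <ᵇ-true = ⌊⌋-true (x ℤ.<? y)

  <ᵇ-false : y ℤ.≤ x → (x <ᵇ y) ≡ false
  <ᵇ-false y≤x = ⌊⌋-false (x ℤ.<? y) (ℤₚ.≤⇒≯ y≤x)

  <ᵇ-sound : (x <ᵇ y) ≡ true → x ℤ.< y
  <ᵇ-sound = ⌊⌋-sound (x ℤ.<? y)

  <ᵇ-asym : (x <ᵇ y) ≡ true → (y <ᵇ x) ≡ false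
  <ᵇ-asym h = ⌊⌋-false (y ℤ.<? x) (ℤₚ.<-asym (<ᵇ-sound h))

  <ᵇ-connex : x ≢ y → (x <ᵇ y) ≡ false → (y <ᵇ x) ≡ true
  <ᵇ-connex x≢y h with ℤₚ.<-cmp x y
  ... | tri< x<y _ _ = ⊥-elim (true≢false (≡.trans (≡.sym (<ᵇ-true x<y)) h))
  ... | tri≈ _ x≡y _ = ⊥-elim (x≢y x≡y)
  ... | tri> _ _ y<x = ⌊⌋-true (y ℤ.<? x) y<x

  <ᵇ-flip : x ≢ y → (y <ᵇ x) ≡ not (x <ᵇ y)
  <ᵇ-flip x≢y = go (x <ᵇ y) ≡.refl
    where
    go : ∀ b → (x <ᵇ y) ≡ b → (y <ᵇ x) ≡ not b
    go true h = <ᵇ-asym h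
    go false h = <ᵇ-connex x≢y h

<ᵇ-trans : ∀ {x y z} → (x <ᵇ y) ≡ true → (y <ᵇ z) ≡ true → (x <ᵇ z) ≡ true
<ᵇ-trans h₁ h₂ = <ᵇ-true (ℤₚ.<-trans (<ᵇ-sound h₁) (<ᵇ-sound h₂))

infix 7 _∈ᵇ_ _⊆ᵇ_

_∈ᵇ_ : ℕ → List ℕ → Bool
a ∈ᵇ [] = false
a ∈ᵇ (b ∷ bs) = ⌊ a ℕ.≟ b ⌋ ∨ a ∈ᵇ bs

_⊆ᵇ_ : List ℕ → List ℕ → Bool
[] ⊆ᵇ V = true
(x ∷ xs) ⊆ᵇ V = x ∈ᵇ V ∧ xs ⊆ᵇ V

delete : ℕ → List ℕ → List ℕ
delete a [] = []
delete a (b ∷ bs) = if ⌊ a ℕ.≟ b ⌋ then bs else b ∷ delete a bs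

𝟙 : Bool → ℕ
𝟙 b = if b then 1 else 0

countBelow : ℕ → List ℕ → ℕ
countBelow a = countB (λ b → ⌊ b ℕ.<? a ⌋)

Sorted : List ℕ → Set
Sorted = AllPairs _<_

∈ᵇ-head : ∀ v vs → v ∈ᵇ (v ∷ vs) ≡ true
∈ᵇ-head v vs rewrite ⌊⌋-true (v ℕ.≟ v) ≡.refl = ≡.refl

∈ᵇ-self : ∀ V → All (λ a → a ∈ᵇ V ≡ true) V
∈ᵇ-self [] = []
∈ᵇ-self (v ∷ vs) = ∈ᵇ-head v vs ∷ All.map (λ h → ≡.trans (≡.cong (_ ∨_) h) (∨-zeroʳ _)) (∈ᵇ-self vs)

∉ᵇ-above : ∀ {a V} → All (a <_) V → a ∈ᵇ V ≡ false
∉ᵇ-above [] = ≡.refl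
∉ᵇ-above {a} {b ∷ _} (a<b ∷ h) rewrite ⌊⌋-false (a ℕ.≟ b) (ℕₚ.<⇒≢ a<b) = ∉ᵇ-above h

length-delete : ∀ a V → a ∈ᵇ V ≡ true → suc (length (delete a V)) ≡ length V
length-delete a (b ∷ bs) h with a ℕ.≟ b
... | yes _ = ≡.refl
... | no _ = ≡.cong suc (length-delete a bs h)

countBelow-delete : ∀ a b V → a ∈ᵇ V ≡ true →
  countBelow b V ≡ 𝟙 ⌊ a ℕ.<? b ⌋ ℕ.+ countBelow b (delete a V)
countBelow-delete a b (c ∷ cs) h with a ℕ.≟ c
... | yes ≡.refl = ≡.refl
... | no _ rewrite countBelow-delete a b cs h = ℕ+.x∙yz≈y∙xz (𝟙 ⌊ c ℕ.<? b ⌋) (𝟙 ⌊ a ℕ.<? b ⌋) _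

∈ᵇ-delete-≢ : ∀ {a b} V → a ≢ b → b ∈ᵇ delete a V ≡ b ∈ᵇ V
∈ᵇ-delete-≢ [] _ = ≡.refl
∈ᵇ-delete-≢ {a} {b} (c ∷ cs) a≢b with a ℕ.≟ c
... | yes ≡.refl rewrite ⌊⌋-false (b ℕ.≟ a) (a≢b ∘ ≡.sym) = ≡.refl
... | no _ = ≡.cong (⌊ b ℕ.≟ c ⌋ ∨_) (∈ᵇ-delete-≢ cs a≢b)

∉ᵇ-delete-self : ∀ a {V} → Sorted V → a ∈ᵇ delete a V ≡ false
∉ᵇ-delete-self a [] = ≡.refl
∉ᵇ-delete-self a {c ∷ _} (h ∷ hs) with a ℕ.≟ c
... | yes ≡.refl = ∉ᵇ-above h
... | no a≢c rewrite ⌊⌋-false (a ℕ.≟ c) a≢c = ∉ᵇ-delete-self a hs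

∈ᵇ-delete : ∀ a b {V} → Sorted V → b ∈ᵇ delete a V ≡ not ⌊ a ℕ.≟ b ⌋ ∧ b ∈ᵇ V
∈ᵇ-delete a b {V} sV with a ℕ.≟ b
... | yes ≡.refl = ∉ᵇ-delete-self a sV
... | no a≢b = ∈ᵇ-delete-≢ V a≢b

⊆ᵇ-delete : ∀ a xs {V} → Sorted V → xs ⊆ᵇ delete a V ≡ notIn a xs ∧ xs ⊆ᵇ V
⊆ᵇ-delete a [] _ = ≡.refl
⊆ᵇ-delete a (x ∷ xs) {V} sV rewrite ∈ᵇ-delete a x sV | ⊆ᵇ-delete a xs sV =
  ∧.interchange (not ⌊ a ℕ.≟ x ⌋) (x ∈ᵇ V) (notIn a xs) (xs ⊆ᵇ V)

All-delete : ∀ {P : ℕ → Set} a {V} → All P V → All P (delete a V)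
All-delete a [] = []
All-delete a {b ∷ _} (h ∷ hs) with a ℕ.≟ b
... | yes _ = hs
... | no _ = h ∷ All-delete a hs

Sorted-delete : ∀ a {V} → Sorted V → Sorted (delete a V)
Sorted-delete a [] = []
Sorted-delete a {b ∷ _} (h ∷ hs) with a ℕ.≟ b
... | yes _ = hs
... | no _ = All-delete a h ∷ Sorted-delete a hs

countBelow-distinct-⊆ : ∀ a xs {V} → Sorted V → distinct xs ≡ true → xs ⊆ᵇ V ≡ true →
  length xs ≡ length V → countBelow a xs ≡ countBelow a V
countBelow-distinct-⊆ a [] {[]} _ _ _ _ = ≡.refl
countBelow-distinct-⊆ a (x ∷ xs) {V} sV d xs⊆V len = begin
  𝟙 ⌊ x ℕ.<? a ⌋ ℕ.+ countBelow a xs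
    ≡⟨ ≡.cong (𝟙 ⌊ x ℕ.<? a ⌋ ℕ.+_)
         (countBelow-distinct-⊆ a xs (Sorted-delete x sV) (∧-trueʳ {notIn x xs} d) xs⊆V-x len-x) ⟩
  𝟙 ⌊ x ℕ.<? a ⌋ ℕ.+ countBelow a (delete x V)
    ≡⟨ ≡.sym (countBelow-delete x a V (∧-trueˡ {x ∈ᵇ V} xs⊆V)) ⟩
  countBelow a V ∎
  where
  open ≡.≡-Reasoning
  xs⊆V-x : xs ⊆ᵇ delete x V ≡ true
  xs⊆V-x = ≡.trans (⊆ᵇ-delete x xs sV) (≡.cong₂ _∧_ (∧-trueˡ {notIn x xs} d) (∧-trueʳ {x ∈ᵇ V} xs⊆V))
  len-x : length xs ≡ length (delete x V)
  len-x = ℕₚ.suc-injective (≡.trans len (≡.sym (length-delete x V (∧-trueˡ {x ∈ᵇ V} xs⊆V))))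

∉ᵇ-head : ∀ {a v} vs → a ∈ᵇ (v ∷ vs) ≡ false → a ≢ v
∉ᵇ-head {a} {v} vs h a≡v with a ℕ.≟ v
... | yes _ = true≢false h
... | no a≢v = a≢v a≡v

∉ᵇ-tail : ∀ {a v} vs → a ∈ᵇ (v ∷ vs) ≡ false → a ∈ᵇ vs ≡ false
∉ᵇ-tail {a} {v} vs h with a ℕ.≟ v
... | no _ = h

delete-head : ∀ v vs → delete v (v ∷ vs) ≡ vs
delete-head v vs rewrite ⌊⌋-true (v ℕ.≟ v) ≡.refl = ≡.refl

delete-second : ∀ {u v} vs → u < v → delete v (u ∷ v ∷ vs) ≡ u ∷ vs
delete-second {u} {v} vs u<v rewrite ⌊⌋-false (v ℕ.≟ u) (ℕₚ.>⇒≢ u<v) | ⌊⌋-true (v ℕ.≟ v) ≡.refl = ≡.refl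

delete-later : ∀ {a u v} vs → u < a → v < a → delete a (u ∷ v ∷ vs) ≡ u ∷ v ∷ delete a vs
delete-later {a} {u} {v} vs u<a v<a
  rewrite ⌊⌋-false (a ℕ.≟ u) (ℕₚ.>⇒≢ u<a) | ⌊⌋-false (a ℕ.≟ v) (ℕₚ.>⇒≢ v<a) = ≡.refl

countBelow-above : ∀ {a V} → All (a <_) V → countBelow a V ≡ 0
countBelow-above [] = ≡.refl
countBelow-above {a} {b ∷ _} (a<b ∷ h) rewrite ⌊⌋-false (b ℕ.<? a) (ℕₚ.<⇒≯ a<b) = countBelow-above h

countBelow-head : ∀ {v vs} → All (v <_) vs → countBelow v (v ∷ vs) ≡ 0
countBelow-head {v} h rewrite ⌊⌋-false (v ℕ.<? v) (ℕₚ.<-irrefl ≡.refl) = countBelow-above h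

countBelow-second : ∀ {u v vs} → u < v → All (v <_) vs → countBelow v (u ∷ v ∷ vs) ≡ 1
countBelow-second {u} {v} u<v h rewrite ⌊⌋-true (u ℕ.<? v) u<v = ≡.cong suc (countBelow-head h)

countFrom : ℕ → ℕ → List ℕ
countFrom s zero = []
countFrom s (suc k) = s ∷ countFrom (suc s) k

length-countFrom : ∀ s k → length (countFrom s k) ≡ k
length-countFrom s zero = ≡.refl
length-countFrom s (suc k) = ≡.cong suc (length-countFrom (suc s) k)

countFrom-above : ∀ {t} s k → t < s → All (t <_) (countFrom s k)
countFrom-above s zero _ = []
countFrom-above s (suc k) t<s = t<s ∷ countFrom-above (suc s) k (ℕₚ.m<n⇒m<1+n t<s)

Sorted-countFrom : ∀ s k → Sorted (countFrom s k)
Sorted-countFrom s zero = []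
Sorted-countFrom s (suc k) = countFrom-above (suc s) k ℕₚ.≤-refl ∷ Sorted-countFrom (suc s) k

countFrom-bounded : ∀ s k {n} → s ℕ.+ k ≤ suc n → All (_≤ n) (countFrom s k)
countFrom-bounded s zero _ = []
countFrom-bounded s (suc k) {n} s+k≤n rewrite ℕₚ.+-suc s k =
  ℕₚ.≤-pred (ℕₚ.≤-trans (s≤s (ℕₚ.m≤m+n s k)) s+k≤n) ∷ countFrom-bounded (suc s) k s+k≤n

∈ᵇ-countFrom : ∀ {a} s k → s ≤ a → a < s ℕ.+ k → a ∈ᵇ countFrom s k ≡ true
∈ᵇ-countFrom s zero s≤a a<s+0 rewrite ℕₚ.+-identityʳ s = ⊥-elim (ℕₚ.<⇒≱ a<s+0 s≤a)
∈ᵇ-countFrom {a} s (suc k) s≤a a<s+k with a ℕ.≟ s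
... | yes _ = ≡.refl
... | no a≢s = ∈ᵇ-countFrom (suc s) k (ℕₚ.≤∧≢⇒< s≤a (a≢s ∘ ≡.sym)) (≡.subst (a <_) (ℕₚ.+-suc s k) a<s+k)

-- Parity, and the inversions created by a first letter

isEven-suc : ∀ m → isEven (suc m) ≡ not (isEven m)
isEven-suc zero = ≡.refl
isEven-suc (suc zero) = ≡.refl
isEven-suc (suc (suc m)) = isEven-suc m

isEven-+1 : ∀ m → isEven (m ℕ.+ 1) ≡ not (isEven m)
isEven-+1 m = ≡.trans (≡.cong isEven (ℕₚ.+-comm m 1)) (isEven-suc m)

isEven-+suc : ∀ m k → isEven (m ℕ.+ suc k) ≡ not (isEven (m ℕ.+ k))
isEven-+suc m k = ≡.trans (≡.cong isEven (ℕₚ.+-suc m k)) (isEven-suc (m ℕ.+ k))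

isEven-+1+ : ∀ m k → isEven (m ℕ.+ 1 ℕ.+ k) ≡ not (isEven (m ℕ.+ k))
isEven-+1+ m k = ≡.trans (≡.cong isEven (ℕₚ.+-assoc m 1 k)) (isEven-+suc m k)

isEven-+-double : ∀ m c → isEven (m ℕ.+ (c ℕ.+ c)) ≡ isEven m
isEven-+-double m zero = ≡.cong isEven (ℕₚ.+-identityʳ m)
isEven-+-double m (suc c) rewrite ℕₚ.+-suc c c | ℕₚ.+-suc m (suc (c ℕ.+ c)) | ℕₚ.+-suc m (c ℕ.+ c) =
  isEven-+-double m c

isEven-double : ∀ m → isEven (m ℕ.+ m) ≡ true
isEven-double = isEven-+-double 0

firstInversions : ℤ → List ℤ → ℕ
firstInversions l w = countB (λ y → y <ᵇ l) w ℕ.+ countB (λ y → y <ᵇ ℤ.- l) w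

-- A letter y with |y| < i + 1 is counted by exactly one of the two comparisons; a letter
-- with |y| > i + 1 by both or by neither.
inversionPair : ∀ i y → ∣ y ∣ ≢ suc i →
  𝟙 (y <ᵇ + suc i) ℕ.+ 𝟙 (y <ᵇ -[1+ i ]) ≡ 𝟙 ⌊ ∣ y ∣ ℕ.<? suc i ⌋ ℕ.+ (𝟙 (y <ᵇ -[1+ i ]) ℕ.+ 𝟙 (y <ᵇ -[1+ i ]))
inversionPair i (+ m) _ rewrite ⌊⌋-⇔ (+ m ℤ.<? + suc i) (m ℕ.<? suc i) ℤₚ.drop‿+<+ ℤ.+<+ = ≡.refl
inversionPair i -[1+ m ] m≢i with ℕₚ.<-cmp m i
... | tri< m<i _ _ rewrite <ᵇ-false (ℤ.-≤- (ℕₚ.<⇒≤ m<i)) | ⌊⌋-true (suc m ℕ.<? suc i) (s≤s m<i) = ≡.refl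
... | tri≈ _ m≡i _ = ⊥-elim (m≢i (≡.cong suc m≡i))
... | tri> _ _ i<m rewrite <ᵇ-true (ℤ.-<- i<m) | ⌊⌋-false (suc m ℕ.<? suc i) (ℕₚ.<⇒≯ (s≤s i<m)) = ≡.refl

notIn-head : ∀ {a x} xs → notIn a (x ∷ xs) ≡ true → x ≢ a
notIn-head {a} {x} _ h x≡a with a ℕ.≟ x
... | yes _ = true≢false (≡.sym h)
... | no a≢x = a≢x (≡.sym x≡a)

notIn-tail : ∀ {a x} xs → notIn a (x ∷ xs) ≡ true → notIn a xs ≡ true
notIn-tail {a} {x} _ = ∧-trueʳ {not ⌊ a ℕ.≟ x ⌋}

firstInversions-pos : ∀ i w → notIn (suc i) (map ∣_∣ w) ≡ true →
  firstInversions (+ suc i) w ≡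
  countBelow (suc i) (map ∣_∣ w) ℕ.+ (countB (_<ᵇ -[1+ i ]) w ℕ.+ countB (_<ᵇ -[1+ i ]) w)
firstInversions-pos i [] _ = ≡.refl
firstInversions-pos i (y ∷ w) h = begin
  (a ℕ.+ A) ℕ.+ (b ℕ.+ B)                   ≡⟨ ℕ+.interchange a A b B ⟩
  (a ℕ.+ b) ℕ.+ (A ℕ.+ B)
    ≡⟨ ≡.cong₂ ℕ._+_ (inversionPair i y (notIn-head (map ∣_∣ w) h))
                     (firstInversions-pos i w (notIn-tail (map ∣_∣ w) h)) ⟩
  (c ℕ.+ (b ℕ.+ b)) ℕ.+ (C ℕ.+ (B ℕ.+ B))   ≡⟨ ℕ+.interchange c (b ℕ.+ b) C (B ℕ.+ B) ⟩
  (c ℕ.+ C) ℕ.+ ((b ℕ.+ b) ℕ.+ (B ℕ.+ B))   ≡⟨ ≡.cong (c ℕ.+ C ℕ.+_) (ℕ+.interchange b b B B) ⟩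
  (c ℕ.+ C) ℕ.+ ((b ℕ.+ B) ℕ.+ (b ℕ.+ B)) ∎
  where
  open ≡.≡-Reasoning
  a = 𝟙 (y <ᵇ + suc i)
  A = countB (_<ᵇ + suc i) w
  B = countB (_<ᵇ -[1+ i ]) w
  C = countBelow (suc i) (map ∣_∣ w)
  b = 𝟙 (y <ᵇ -[1+ i ])
  c = 𝟙 ⌊ ∣ y ∣ ℕ.<? suc i ⌋

countBelow-zero : ∀ xs → countBelow 0 xs ≡ 0
countBelow-zero [] = ≡.refl
countBelow-zero (x ∷ xs) rewrite ⌊⌋-false (x ℕ.<? 0) ℕₚ.n≮0 = countBelow-zero xs

firstInversions-parity : ∀ l w → notIn ∣ l ∣ (map ∣_∣ w) ≡ true →
  isEven (firstInversions l w) ≡ isEven (countBelow ∣ l ∣ (map ∣_∣ w))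
firstInversions-parity (+ zero) w _ rewrite countBelow-zero (map ∣_∣ w) = isEven-double (countB (_<ᵇ + 0) w)
firstInversions-parity (+ suc i) w h rewrite firstInversions-pos i w h =
  isEven-+-double (countBelow (suc i) (map ∣_∣ w)) (countB (_<ᵇ -[1+ i ]) w)
firstInversions-parity -[1+ i ] w h
  rewrite ℕₚ.+-comm (countB (_<ᵇ -[1+ i ]) w) (countB (_<ᵇ + suc i) w) | firstInversions-pos i w h =
  isEven-+-double (countBelow (suc i) (map ∣_∣ w)) (countB (_<ᵇ -[1+ i ]) w)

firstInversions-rank : ∀ l w {V} → Sorted V → ∣ l ∣ ∈ᵇ V ≡ true → distinct (map ∣_∣ w) ≡ true →
  map ∣_∣ w ⊆ᵇ delete ∣ l ∣ V ≡ true → length w ≡ length (delete ∣ l ∣ V) →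
  isEven (firstInversions l w) ≡ isEven (countBelow ∣ l ∣ V)
firstInversions-rank l w {V} sV l∈V d w⊆V-l len = begin
  isEven (firstInversions l w)                        ≡⟨ firstInversions-parity l w (∧-trueˡ l∉w×w⊆V) ⟩
  isEven (countBelow a (map ∣_∣ w))                   ≡⟨ ≡.cong isEven below-w ⟩
  isEven (𝟙 ⌊ a ℕ.<? a ⌋ ℕ.+ countBelow a (delete a V)) ≡⟨ ≡.cong isEven (countBelow-delete a a V l∈V) ⟨
  isEven (countBelow a V) ∎
  where
  open ≡.≡-Reasoning
  a = ∣ l ∣
  l∉w×w⊆V : notIn a (map ∣_∣ w) ∧ map ∣_∣ w ⊆ᵇ V ≡ true
  l∉w×w⊆V = ≡.trans (≡.sym (⊆ᵇ-delete a (map ∣_∣ w) sV)) w⊆V-l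
  below-w : countBelow a (map ∣_∣ w) ≡ 𝟙 ⌊ a ℕ.<? a ⌋ ℕ.+ countBelow a (delete a V)
  below-w rewrite ⌊⌋-false (a ℕ.<? a) (ℕₚ.<-irrefl ≡.refl) =
    countBelow-distinct-⊆ a (map ∣_∣ w) (Sorted-delete a sV) d w⊆V-l (≡.trans (length-map ∣_∣ w) len)

≢-signed : ∀ {x a} → ∣ x ∣ ≢ a → x ≢ + a × x ≢ ℤ.- (+ a)
≢-signed {a = a} ∣x∣≢a = (λ x≡a → ∣x∣≢a (≡.cong ∣_∣ x≡a))
                      , (λ x≡-a → ∣x∣≢a (≡.trans (≡.cong ∣_∣ x≡-a) (ℤₚ.∣-i∣≡∣i∣ (+ a))))

module ListSum {c ℓ} (R : CommutativeRing c ℓ) where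
  open CommutativeRing R
  module +-Props = CommSemigroupProps +-commutativeSemigroup

  Σ : ∀ {a} {A : Set a} → (A → Carrier) → List A → Carrier
  Σ f = foldr (λ x acc → f x + acc) 0#

  module _ {a} {A : Set a} where

    Σ-cong : ∀ {f g : A → Carrier} L → (∀ x → f x ≈ g x) → Σ f L ≈ Σ g L
    Σ-cong [] _ = refl
    Σ-cong (x ∷ L) f≈g = +-cong (f≈g x) (Σ-cong L f≈g)

    Σ-cong-All : ∀ {p} {P : A → Set p} {f g : A → Carrier} {L} → All P L →
      (∀ x → P x → f x ≈ g x) → Σ f L ≈ Σ g L
    Σ-cong-All [] _ = refl
    Σ-cong-All (px ∷ pL) f≈g = +-cong (f≈g _ px) (Σ-cong-All pL f≈g)

    Σ-0 : ∀ L → Σ {A = A} (λ _ → 0#) L ≈ 0#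
    Σ-0 [] = refl
    Σ-0 (_ ∷ L) = trans (+-identityˡ _) (Σ-0 L)

    Σ-++ : ∀ (f : A → Carrier) L M → Σ f (L ++ M) ≈ Σ f L + Σ f M
    Σ-++ f [] M = sym (+-identityˡ _)
    Σ-++ f (x ∷ L) M = trans (+-congˡ (Σ-++ f L M)) (sym (+-assoc _ _ _))

    Σ-+ : ∀ (f g : A → Carrier) L → Σ (λ x → f x + g x) L ≈ Σ f L + Σ g L
    Σ-+ f g [] = sym (+-identityˡ 0#)
    Σ-+ f g (x ∷ L) = trans (+-congˡ (Σ-+ f g L)) (+-Props.interchange _ _ _ _)

    Σ-*ˡ : ∀ a (f : A → Carrier) L → Σ (λ x → a * f x) L ≈ a * Σ f L
    Σ-*ˡ a f [] = sym (zeroʳ a)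
    Σ-*ˡ a f (x ∷ L) = trans (+-congˡ (Σ-*ˡ a f L)) (sym (distribˡ a _ _))

    Σ-if : ∀ (P : A → Bool) (f : A → Carrier) L →
      Σ f (filter (λ x → P x ≟ᵇ true) L) ≈ Σ (λ x → if P x then f x else 0#) L
    Σ-if P f [] = refl
    Σ-if P f (x ∷ L) with P x
    ... | true = +-congˡ (Σ-if P f L)
    ... | false = trans (Σ-if P f L) (sym (+-identityˡ _))

  module _ {a b} {A : Set a} {B : Set b} where

    Σ-map : ∀ (f : B → Carrier) (h : A → B) L → Σ f (map h L) ≡ Σ (f ∘ h) L
    Σ-map f h [] = ≡.refl
    Σ-map f h (x ∷ L) = ≡.cong (_+_ (f (h x))) (Σ-map f h L)

    Σ-concatMap : ∀ (f : B → Carrier) (g : A → List B) L → Σ f (concatMap g L) ≈ Σ (Σ f ∘ g) L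
    Σ-concatMap f g [] = refl
    Σ-concatMap f g (x ∷ L) = trans (Σ-++ f (g x) (concat (map g L))) (+-congˡ (Σ-concatMap f g L))

    Σ-swap : ∀ (F : A → B → Carrier) L M → Σ (λ x → Σ (F x) M) L ≈ Σ (λ y → Σ (λ x → F x y) L) M
    Σ-swap F [] M = sym (Σ-0 M)
    Σ-swap F (x ∷ L) M = trans (+-congˡ (Σ-swap F L M)) (sym (Σ-+ (F x) _ M))

  sumTo : (ℕ → Carrier) → ℕ → Carrier
  sumTo g zero = 0#
  sumTo g (suc k) = g 0 + sumTo (g ∘ suc) k

  Σ-applyUpTo : ∀ (F : ℕ → Carrier) f k → Σ F (applyUpTo f k) ≡ sumTo (F ∘ f) k
  Σ-applyUpTo F f zero = ≡.refl
  Σ-applyUpTo F f (suc k) = ≡.cong (_+_ (F (f 0))) (Σ-applyUpTo F (f ∘ suc) k)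

  sumTo-cong : ∀ k {g h : ℕ → Carrier} → (∀ i → i < k → g i ≈ h i) → sumTo g k ≈ sumTo h k
  sumTo-cong zero _ = refl
  sumTo-cong (suc k) g≈h = +-cong (g≈h 0 (s≤s z≤n)) (sumTo-cong k (λ i i<k → g≈h (suc i) (s≤s i<k)))

  sumTo-+ : ∀ k (g h : ℕ → Carrier) → sumTo (λ i → g i + h i) k ≈ sumTo g k + sumTo h k
  sumTo-+ zero g h = sym (+-identityˡ 0#)
  sumTo-+ (suc k) g h = trans (+-congˡ (sumTo-+ k (g ∘ suc) (h ∘ suc))) (+-Props.interchange _ _ _ _)

  sumTo-0 : ∀ k → sumTo (λ _ → 0#) k ≈ 0#
  sumTo-0 zero = refl
  sumTo-0 (suc k) = trans (+-identityˡ _) (sumTo-0 k)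

  sumTo-point : ∀ k j (g : ℕ → Carrier) → j < k → (∀ i → i ≢ j → g i ≈ 0#) → sumTo g k ≈ g j
  sumTo-point (suc k) zero g _ g≈0 =
    trans (+-congˡ (trans (sumTo-cong k (λ i _ → g≈0 (suc i) λ ())) (sumTo-0 k))) (+-identityʳ _)
  sumTo-point (suc k) (suc j) g (s≤s j<k) g≈0 =
    trans (+-cong (g≈0 0 λ ()) (sumTo-point k j (g ∘ suc) j<k (λ i i≢j → g≈0 (suc i) (i≢j ∘ ℕₚ.suc-injective))))
          (+-identityˡ _)

-- Extending a prefix by one letter

module Extension {c ℓ} (R : CommutativeRing c ℓ) (p q : CommutativeRing.Carrier R) where
  open CommutativeRing R
  open RingEval R
  open ListSum R
  open import Relation.Binary.Reasoning.Setoid setoid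
  open import Algebra.Properties.Ring ring using (-‿distribˡ-*; -‿involutive)
  open import Algebra.Solver.CommutativeMonoid *-commutativeMonoid using (solve; _⊜_; _⊕_)

  sgn-suc : ∀ m → sgn (suc m) ≈ - sgn m
  sgn-suc m rewrite isEven-suc m with isEven m
  ... | true = refl
  ... | false = sym (-‿involutive 1#)

  sgn-+ : ∀ a b → sgn (a ℕ.+ b) ≈ sgn a * sgn b
  sgn-+ zero b = sym (*-identityˡ _)
  sgn-+ (suc a) b = begin
    sgn (suc (a ℕ.+ b)) ≈⟨ sgn-suc (a ℕ.+ b) ⟩
    - sgn (a ℕ.+ b)     ≈⟨ -‿cong (sgn-+ a b) ⟩
    - (sgn a * sgn b)   ≈⟨ -‿distribˡ-* _ _ ⟩
    - sgn a * sgn b     ≈⟨ *-congʳ (sgn-suc a) ⟨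
    sgn (suc a) * sgn b ∎

  pow-𝟙 : ∀ x b m → pow x (𝟙 b ℕ.+ m) ≈ (if b then x else 1#) * pow x m
  pow-𝟙 x true m = refl
  pow-𝟙 x false m = sym (*-identityˡ _)

  peakAt : ℤ → ℤ → ℤ → Carrier
  peakAt y x l = if (y <ᵇ x) ∧ (l <ᵇ x) then p else 1#

  valleyAt : ℤ → ℤ → ℤ → Carrier
  valleyAt y x l = if (x <ᵇ y) ∧ (x <ᵇ l) then q else 1#

  negBit : ℤ → ℕ
  negBit l = 𝟙 (l <ᵇ + 0)

  weightFrom : ℤ → ℤ → List ℤ → Carrier
  weightFrom y x w = sgn (invD w) * (pow p (pkList (y ∷ x ∷ w)) * pow q (valList (y ∷ x ∷ w)))

  extend : List ℕ → ℤ → ℤ → ℤ → Carrier → Carrier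
  extend V y x l t = sgn (countBelow ∣ l ∣ V) * (peakAt y x l * (valleyAt y x l * t))

  extend-cong : ∀ V y x l {s t} → s ≈ t → extend V y x l s ≈ extend V y x l t
  extend-cong V y x l s≈t = *-congˡ (*-congˡ (*-congˡ s≈t))

  extend-0 : ∀ V y x l → extend V y x l 0# ≈ 0#
  extend-0 V y x l = trans (*-congˡ (trans (*-congˡ (zeroʳ _)) (zeroʳ _))) (zeroʳ _)

  guard-cong : ∀ b {s t} → s ≈ t → (if b then s else 0#) ≈ (if b then t else 0#)
  guard-cong true s≈t = s≈t
  guard-cong false _ = refl

  extend-if : ∀ V y x l b t → extend V y x l (if b then t else 0#) ≈ (if b then extend V y x l t else 0#)
  extend-if V y x l true t = refl
  extend-if V y x l false t = extend-0 V y x l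

  weightFrom-cons : ∀ V y x l w → isEven (firstInversions l w) ≡ isEven (countBelow ∣ l ∣ V) →
    weightFrom y x (l ∷ w) ≈ extend V y x l (weightFrom x l w)
  weightFrom-cons V y x l w parity = begin
    sgn (firstInversions l w ℕ.+ invD w) * (pow p (𝟙 isPeak ℕ.+ pk) * pow q (𝟙 isValley ℕ.+ val))
      ≈⟨ *-cong (sgn-+ (firstInversions l w) (invD w)) (*-cong (pow-𝟙 p isPeak pk) (pow-𝟙 q isValley val)) ⟩
    (sgn (firstInversions l w) * sgn (invD w)) * ((peakAt y x l * pow p pk) * (valleyAt y x l * pow q val))
      ≈⟨ solve 6 (λ s s′ a P b Q → (s ⊕ s′) ⊕ ((a ⊕ P) ⊕ (b ⊕ Q)) ⊜ s ⊕ (a ⊕ (b ⊕ (s′ ⊕ (P ⊕ Q))))) refl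
           (sgn (firstInversions l w)) (sgn (invD w)) (peakAt y x l) (pow p pk) (valleyAt y x l) (pow q val) ⟩
    sgn (firstInversions l w) * (peakAt y x l * (valleyAt y x l * weightFrom x l w))
      ≡⟨ ≡.cong (λ b → (if b then 1# else - 1#) * _) parity ⟩
    extend V y x l (weightFrom x l w) ∎
    where
    isPeak = (y <ᵇ x) ∧ (l <ᵇ x)
    isValley = (x <ᵇ y) ∧ (x <ᵇ l)
    pk = pkList (x ∷ l ∷ w)
    val = valList (x ∷ l ∷ w)

  TailDetermined : (List ℤ → Bool) → Set
  TailDetermined md = ∀ a b l w → md (a ∷ b ∷ l ∷ w) ≡ md (b ∷ l ∷ w)

  admissible : (List ℤ → Bool) → List ℕ → ℤ → ℤ → ℕ → List ℤ → Bool
  admissible md V y x e w =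
    md (y ∷ x ∷ w) ∧ (distinct (map ∣_∣ w) ∧ (map ∣_∣ w ⊆ᵇ V ∧ isEven (e ℕ.+ negCount w)))

  tailTerm : (List ℤ → Bool) → List ℕ → ℤ → ℤ → ℕ → List ℤ → Carrier
  tailTerm md V y x e w = if admissible md V y x e w then weightFrom y x w else 0#

  admissible-cons : ∀ {md} → TailDetermined md → ∀ {V} → Sorted V → ∀ y x e l w →
    admissible md V y x e (l ∷ w) ≡ ∣ l ∣ ∈ᵇ V ∧ admissible md (delete ∣ l ∣ V) x l (e ℕ.+ negBit l) w
  admissible-cons {md} tailDet {V} sV y x e l w
    rewrite tailDet y x l w | ⊆ᵇ-delete ∣ l ∣ (map ∣_∣ w) sV | ℕₚ.+-assoc e (negBit l) (negCount w) =
    rearrange (md (x ∷ l ∷ w)) (notIn ∣ l ∣ (map ∣_∣ w)) (distinct (map ∣_∣ w)) (∣ l ∣ ∈ᵇ V) _ _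
    where
    rearrange : ∀ m n d l∈ a e → m ∧ ((n ∧ d) ∧ ((l∈ ∧ a) ∧ e)) ≡ l∈ ∧ (m ∧ (d ∧ ((n ∧ a) ∧ e)))
    rearrange m n d false a e rewrite ∧-zeroʳ (n ∧ d) = ∧-zeroʳ m
    rearrange false n d true a e = ≡.refl
    rearrange true false d true a e rewrite ∧-zeroʳ d = ≡.refl
    rearrange true true d true a e = ≡.refl

  tailTerm-cons : ∀ {md} → TailDetermined md → ∀ {V} → Sorted V → ∀ y x e l w → length V ≡ suc (length w) →
    tailTerm md V y x e (l ∷ w) ≈
    (if ∣ l ∣ ∈ᵇ V then extend V y x l (tailTerm md (delete ∣ l ∣ V) x l (e ℕ.+ negBit l) w) else 0#)
  tailTerm-cons {md} tailDet {V} sV y x e l w len = begin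
    tailTerm md V y x e (l ∷ w)
      ≡⟨ ≡.cong (λ b → if b then weightFrom y x (l ∷ w) else 0#) (admissible-cons {md} tailDet sV y x e l w) ⟩
    (if ∣ l ∣ ∈ᵇ V ∧ admissible md V′ x l e′ w then weightFrom y x (l ∷ w) else 0#)
      ≈⟨ split (∣ l ∣ ∈ᵇ V) (admissible md V′ x l e′ w) ≡.refl ≡.refl ⟩
    (if ∣ l ∣ ∈ᵇ V then extend V y x l (tailTerm md V′ x l e′ w) else 0#) ∎
    where
    V′ = delete ∣ l ∣ V
    e′ = e ℕ.+ negBit l
    split : ∀ m a → ∣ l ∣ ∈ᵇ V ≡ m → admissible md V′ x l e′ w ≡ a →
      (if m ∧ a then weightFrom y x (l ∷ w) else 0#) ≈
      (if m then extend V y x l (if a then weightFrom x l w else 0#) else 0#)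
    split false a _ _ = refl
    split true false _ _ = sym (extend-0 V y x l)
    split true true l∈V adm = weightFrom-cons V y x l w
      (firstInversions-rank l w sV l∈V (∧-trueˡ (∧-trueʳ {md (x ∷ l ∷ w)} adm))
        (∧-trueˡ (∧-trueʳ {distinct (map ∣_∣ w)} (∧-trueʳ {md (x ∷ l ∷ w)} adm)))
        (ℕₚ.suc-injective (≡.trans (≡.sym len) (≡.sym (length-delete ∣ l ∣ V l∈V)))))

  Σ-extend : ∀ {a} {A : Set a} V y x l (f : A → Carrier) L →
    Σ (λ w → extend V y x l (f w)) L ≈ extend V y x l (Σ f L)
  Σ-extend V y x l f L =
    trans (Σ-*ˡ _ _ L) (*-congˡ (trans (Σ-*ˡ _ _ L) (*-congˡ (Σ-*ˡ _ _ L))))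

  -- A state (k, V, y, x, e): k letters remain to be placed, V is the sorted list of unused
  -- absolute values, y and x are the last two letters placed, and e counts the negative letters.
  StateFn : Set c
  StateFn = ℕ → List ℕ → ℤ → ℤ → ℕ → Carrier

  baseClosed : (List ℤ → Bool) → ℤ → ℤ → ℕ → Carrier
  baseClosed md y x e = if md (y ∷ x ∷ []) then (if isEven e then 1# else 0#) else 0#

  expandTerm : StateFn → ℕ → List ℕ → ℤ → ℤ → ℕ → ℤ → Carrier
  expandTerm F k V y x e l = extend V y x l (F k (delete ∣ l ∣ V) x l (e ℕ.+ negBit l))

  expand : StateFn → ℕ → List ℕ → ℤ → ℤ → ℕ → Carrier
  expand F k V y x e = Σ (λ a → expandTerm F k V y x e (+ a) + expandTerm F k V y x e (ℤ.- (+ a))) V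

-- Summing over all completions

module Expansion {c ℓ} (R : CommutativeRing c ℓ) (n : ℕ) (p q : CommutativeRing.Carrier R) where
  open CommutativeRing R
  open RingEval R
  open ListSum R
  open Extension R p q
  open import Relation.Binary.Reasoning.Setoid setoid

  Letter : ℤ → Set
  Letter y = 0 < ∣ y ∣ × ∣ y ∣ ≤ n

  Bounded : List ℕ → Set
  Bounded = All (λ v → 0 < v × v ≤ n)

  Σ-letters : ∀ (F : ℤ → Carrier) → Σ F (letters n) ≈ sumTo (λ i → F (+ suc i)) n + sumTo (λ i → F -[1+ i ]) n
  Σ-letters F = begin
    Σ F (letters n)
      ≈⟨ Σ-++ F (map (λ i → + suc i) (upTo n)) (map -[1+_] (upTo n)) ⟩
    Σ F (map (λ i → + suc i) (upTo n)) + Σ F (map -[1+_] (upTo n))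
      ≡⟨ ≡.cong₂ _+_ (≡.trans (Σ-map F _ (upTo n)) (Σ-applyUpTo _ (λ i → i) n))
                     (≡.trans (Σ-map F _ (upTo n)) (Σ-applyUpTo _ (λ i → i) n)) ⟩
    sumTo (λ i → F (+ suc i)) n + sumTo (λ i → F -[1+ i ]) n ∎

  Σ-letters-cong : ∀ {F G} → (∀ l → Letter l → F l ≈ G l) → Σ F (letters n) ≈ Σ G (letters n)
  Σ-letters-cong {F} {G} F≈G = begin
    Σ F (letters n)                                           ≈⟨ Σ-letters F ⟩
    sumTo (λ i → F (+ suc i)) n + sumTo (λ i → F -[1+ i ]) n
      ≈⟨ +-cong (sumTo-cong n (λ i i<n → F≈G (+ suc i) (s≤s z≤n , i<n)))
                (sumTo-cong n (λ i i<n → F≈G -[1+ i ] (s≤s z≤n , i<n))) ⟩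
    sumTo (λ i → G (+ suc i)) n + sumTo (λ i → G -[1+ i ]) n ≈⟨ Σ-letters G ⟨
    Σ G (letters n) ∎

  Σ-words : ∀ f k → Σ f (words (suc k) n) ≈ Σ (λ w → Σ (λ l → f (l ∷ w)) (letters n)) (words k n)
  Σ-words f k = trans (Σ-concatMap f (λ w → map (_∷ w) (letters n)) (words k n))
                      (Σ-cong (words k n) (λ w → reflexive (Σ-map f (_∷ w) (letters n))))

  Σ-words-cong : ∀ k {f g} → (∀ w → length w ≡ k → All Letter w → f w ≈ g w) →
    Σ f (words k n) ≈ Σ g (words k n)
  Σ-words-cong zero f≈g = +-congʳ (f≈g [] ≡.refl [])
  Σ-words-cong (suc k) {f} {g} f≈g = begin
    Σ f (words (suc k) n)                                      ≈⟨ Σ-words f k ⟩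
    Σ (λ w → Σ (λ l → f (l ∷ w)) (letters n)) (words k n)
      ≈⟨ Σ-words-cong k (λ w len ws → Σ-letters-cong (λ l l′ → f≈g (l ∷ w) (≡.cong suc len) (l′ ∷ ws))) ⟩
    Σ (λ w → Σ (λ l → g (l ∷ w)) (letters n)) (words k n)      ≈⟨ Σ-words g k ⟨
    Σ g (words (suc k) n) ∎

  sumTo-∈ᵇ : ∀ (F : ℕ → Carrier) {V} → Sorted V → Bounded V →
    sumTo (λ i → if suc i ∈ᵇ V then F (suc i) else 0#) n ≈ Σ F V
  sumTo-∈ᵇ F [] [] = sumTo-0 n
  sumTo-∈ᵇ F {suc j ∷ vs} (v<vs ∷ sV) ((_ , j<n) ∷ bV) = begin
    sumTo (λ i → if suc i ∈ᵇ (suc j ∷ vs) then F (suc i) else 0#) n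
      ≈⟨ sumTo-cong n (λ i _ → split i) ⟩
    sumTo (λ i → at i + rest i) n                 ≈⟨ sumTo-+ n at rest ⟩
    sumTo at n + sumTo rest n                     ≈⟨ +-cong (sumTo-point n j at j<n at-other) (sumTo-∈ᵇ F sV bV) ⟩
    at j + Σ F vs                                 ≡⟨ ≡.cong (λ b → (if b then F (suc j) else 0#) + Σ F vs)
                                                             (⌊⌋-true (suc j ℕ.≟ suc j) ≡.refl) ⟩
    F (suc j) + Σ F vs ∎
    where
    at rest : ℕ → Carrier
    at i = if ⌊ suc i ℕ.≟ suc j ⌋ then F (suc i) else 0#
    rest i = if suc i ∈ᵇ vs then F (suc i) else 0#
    at-other : ∀ i → i ≢ j → at i ≈ 0#
    at-other i i≢j rewrite ⌊⌋-false (suc i ℕ.≟ suc j) (i≢j ∘ ℕₚ.suc-injective) = refl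
    split : ∀ i → (if suc i ∈ᵇ (suc j ∷ vs) then F (suc i) else 0#) ≈ at i + rest i
    split i with suc i ℕ.≟ suc j
    ... | yes ≡.refl rewrite ∉ᵇ-above v<vs = sym (+-identityʳ _)
    ... | no _ = sym (+-identityˡ _)

  Σ-letters-∈ᵇ : ∀ (G : ℤ → Carrier) {V} → Sorted V → Bounded V →
    Σ (λ l → if ∣ l ∣ ∈ᵇ V then G l else 0#) (letters n) ≈ Σ (λ a → G (+ a) + G (ℤ.- (+ a))) V
  Σ-letters-∈ᵇ G {V} sV bV = begin
    Σ (λ l → if ∣ l ∣ ∈ᵇ V then G l else 0#) (letters n)
      ≈⟨ Σ-letters (λ l → if ∣ l ∣ ∈ᵇ V then G l else 0#) ⟩
    sumTo (λ i → if suc i ∈ᵇ V then G (+ suc i) else 0#) n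
      + sumTo (λ i → if suc i ∈ᵇ V then G -[1+ i ] else 0#) n
      ≈⟨ +-cong (sumTo-∈ᵇ (λ a → G (+ a)) sV bV) (sumTo-∈ᵇ (λ a → G (ℤ.- (+ a))) sV bV) ⟩
    Σ (λ a → G (+ a)) V + Σ (λ a → G (ℤ.- (+ a))) V
      ≈⟨ Σ-+ (λ a → G (+ a)) (λ a → G (ℤ.- (+ a))) V ⟨
    Σ (λ a → G (+ a) + G (ℤ.- (+ a))) V ∎

  tailSum : (List ℤ → Bool) → StateFn
  tailSum md k V y x e = Σ (tailTerm md V y x e) (words k n)

  tailSum-empty : ∀ md y x e → tailSum md 0 [] y x e ≈ baseClosed md y x e
  tailSum-empty md y x e rewrite ℕₚ.+-identityʳ e with md (y ∷ x ∷ []) | isEven e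
  ... | true | true = trans (+-identityʳ _) (trans (*-identityˡ _) (*-identityˡ _))
  ... | true | false = +-identityʳ _
  ... | false | _ = +-identityʳ _

  tailSum-step : ∀ {md} → TailDetermined md → ∀ k {V} → Sorted V → Bounded V → length V ≡ suc k →
    ∀ y x e → tailSum md (suc k) V y x e ≈ expand (tailSum md) k V y x e
  tailSum-step {md} tailDet k {V} sV bV len y x e = begin
    Σ (tailTerm md V y x e) (words (suc k) n)                                  ≈⟨ Σ-words _ k ⟩
    Σ (λ w → Σ (λ l → tailTerm md V y x e (l ∷ w)) (letters n)) (words k n)
      ≈⟨ Σ-words-cong k (λ w lenw _ → Σ-cong (letters n) (λ l →
           tailTerm-cons {md} tailDet sV y x e l w (≡.trans len (≡.cong suc (≡.sym lenw))))) ⟩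
    Σ (λ w → Σ (λ l → T l w) (letters n)) (words k n)
      ≈⟨ Σ-swap (λ w l → T l w) (words k n) (letters n) ⟩
    Σ (λ l → Σ (T l) (words k n)) (letters n)                                  ≈⟨ Σ-cong (letters n) sum-T ⟩
    Σ (λ l → if ∣ l ∣ ∈ᵇ V then expandTerm (tailSum md) k V y x e l else 0#) (letters n)
      ≈⟨ Σ-letters-∈ᵇ (expandTerm (tailSum md) k V y x e) sV bV ⟩
    expand (tailSum md) k V y x e ∎
    where
    T : ℤ → List ℤ → Carrier
    T l w = if ∣ l ∣ ∈ᵇ V then extend V y x l (tailTerm md (delete ∣ l ∣ V) x l (e ℕ.+ negBit l) w) else 0#
    sum-T : ∀ l → Σ (T l) (words k n) ≈ (if ∣ l ∣ ∈ᵇ V then expandTerm (tailSum md) k V y x e l else 0#)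
    sum-T l with ∣ l ∣ ∈ᵇ V
    ... | true = Σ-extend V y x l _ (words k n)
    ... | false = Σ-0 (words k n)

  tailSum-closed : ∀ {md} → TailDetermined md → (F : StateFn) →
    (∀ y x e → F 0 [] y x e ≈ baseClosed md y x e) →
    (∀ k V y x e → Sorted V → All (0 <_) V → length V ≡ suc k → ∣ x ∣ ∈ᵇ V ≡ false →
       expand F k V y x e ≈ F (suc k) V y x e) →
    ∀ k {V} → Sorted V → Bounded V → length V ≡ k → ∀ y x e → ∣ x ∣ ∈ᵇ V ≡ false →
    tailSum md k V y x e ≈ F k V y x e
  tailSum-closed {md} _ F base _ zero {[]} _ _ _ y x e _ = trans (tailSum-empty md y x e) (sym (base y x e))
  tailSum-closed {md} tailDet F base step (suc k) {V} sV bV len y x e x∉V = begin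
    tailSum md (suc k) V y x e   ≈⟨ tailSum-step {md} tailDet k sV bV len y x e ⟩
    expand (tailSum md) k V y x e ≈⟨ Σ-cong-All (All.zip (∈ᵇ-self V , bV)) by-IH ⟩
    expand F k V y x e            ≈⟨ step k V y x e sV (All.map proj₁ bV) len x∉V ⟩
    F (suc k) V y x e ∎
    where
    IH : ∀ a → a ∈ᵇ V ≡ true → ∀ l → ∣ l ∣ ≡ a →
      tailSum md k (delete a V) x l (e ℕ.+ negBit l) ≈ F k (delete a V) x l (e ℕ.+ negBit l)
    IH a a∈V l ≡.refl = tailSum-closed {md} tailDet F base step k (Sorted-delete a sV) (All-delete a bV)
      (ℕₚ.suc-injective (≡.trans (length-delete a V a∈V) len)) x l _ (∉ᵇ-delete-self a sV)
    by-IH : ∀ a → a ∈ᵇ V ≡ true × (0 < a × a ≤ n) →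
      expandTerm (tailSum md) k V y x e (+ a) + expandTerm (tailSum md) k V y x e (ℤ.- (+ a)) ≈
      expandTerm F k V y x e (+ a) + expandTerm F k V y x e (ℤ.- (+ a))
    by-IH (suc j) (a∈V , _) = +-cong (extend-cong V y x _ (IH (suc j) a∈V (+ suc j) ≡.refl))
                                     (extend-cong V y x _ (IH (suc j) a∈V -[1+ j ] ≡.refl))

-- The transfer coefficients

data Slope : Set where
  up down flat : Slope

slope : ℤ → ℤ → Slope
slope y x = if y <ᵇ x then up else if x <ᵇ y then down else flat

reverse : Slope → Slope
reverse up = down
reverse down = up
reverse flat = flat

module Coefficients {c ℓ} (R : CommutativeRing c ℓ) (p q : CommutativeRing.Carrier R) where
  open CommutativeRing R
  open RingEval R
  open import Algebra.Properties.Ring ring using (-‿distribˡ-*; -0#≈0#)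

  peakWeight : Slope → Carrier
  peakWeight up = p
  peakWeight _ = 1#

  valleyWeight : Slope → Carrier
  valleyWeight down = q
  valleyWeight _ = 1#

  ascCoef : ℕ → Slope → Carrier
  ascCoef zero up = 1#
  ascCoef zero _ = 0#
  ascCoef (suc k) s = valleyWeight s * ascCoef k up + - (peakWeight s * ascCoef k down)

  desCoef : ℕ → Slope → Carrier
  desCoef zero down = 1#
  desCoef zero _ = 0#
  desCoef (suc k) s = peakWeight s * desCoef k down + - (valleyWeight s * desCoef k up)

  private
    minus-0 : ∀ a {b} → b ≈ 0# → a + - b ≈ a
    minus-0 a b≈0 = trans (+-congˡ (trans (-‿cong b≈0) -0#≈0#)) (+-identityʳ a)

  factor : ∀ a X → 1# * X + - (a * X) ≈ oneMinus a * X
  factor a X = sym (trans (distribʳ X 1# (- a)) (+-congˡ (sym (-‿distribˡ-* a X))))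

  ascCoef-even : ∀ j → ascCoef (j ℕ.+ j) up ≈ pow (oneMinus (p * q)) j × ascCoef (j ℕ.+ j) down ≈ 0#
  ascCoef-odd : ∀ j → ascCoef (suc (j ℕ.+ j)) up ≈ pow (oneMinus (p * q)) j
                    × ascCoef (suc (j ℕ.+ j)) down ≈ q * pow (oneMinus (p * q)) j

  ascCoef-even zero = refl , refl
  ascCoef-even (suc j) rewrite ℕₚ.+-suc j j with ascCoef-odd j
  ... | odd-up , odd-down =
    trans (+-cong (*-congˡ odd-up) (-‿cong (*-congˡ odd-down)))
          (trans (+-congˡ (-‿cong (sym (*-assoc p q _)))) (factor (p * q) _)) ,
    trans (+-cong (*-congˡ odd-up) (-‿cong (trans (*-identityˡ _) odd-down))) (-‿inverseʳ _)

  ascCoef-odd j with ascCoef-even j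
  ... | even-up , even-down =
    trans (minus-0 _ (trans (*-congˡ even-down) (zeroʳ p))) (trans (*-identityˡ _) even-up) ,
    trans (minus-0 _ (trans (*-identityˡ _) even-down)) (*-congˡ even-up)

  ascCoef-flat-odd : ∀ k → ascCoef (suc (k ℕ.+ k)) flat ≈ pow (oneMinus (p * q)) k
  ascCoef-flat-odd k with ascCoef-even k
  ... | even-up , even-down = trans (minus-0 _ (trans (*-identityˡ _) even-down)) (trans (*-identityˡ _) even-up)

  ascCoef-flat-even : ∀ m → ascCoef (suc (suc (m ℕ.+ m))) flat ≈ oneMinus q * pow (oneMinus (p * q)) m
  ascCoef-flat-even m with ascCoef-odd m
  ... | odd-up , odd-down =
    trans (+-cong (*-congˡ odd-up) (-‿cong (*-identityˡ _))) (trans (+-congˡ (-‿cong odd-down)) (factor q _))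

-- Closed form of the completion sums

module ClosedForms {c ℓ} (R : CommutativeRing c ℓ) (p q : CommutativeRing.Carrier R) where
  open CommutativeRing R
  open RingEval R
  open ListSum R
  open Extension R p q
  open import Relation.Binary.Reasoning.Setoid setoid
  open import Algebra.Properties.Ring ring using (-1*x≈-x; -0#≈0#)

  open Coefficients R p q

  -- v and v′ are the two smallest unused values; when there is no v′ it is taken to be ∞.
  belowNegMin : ℕ → List ℕ → ℤ → Bool
  belowNegMin v [] x = x <ᵇ ℤ.- (+ v)
  belowNegMin v (v′ ∷ _) x = (ℤ.- (+ v′) <ᵇ x) ∧ (x <ᵇ ℤ.- (+ v))

  aboveMin : ℕ → List ℕ → ℤ → Bool
  aboveMin v [] x = + v <ᵇ x
  aboveMin v (v′ ∷ _) x = (+ v <ᵇ x) ∧ (x <ᵇ + v′)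

  insideMin : ℕ → ℤ → Bool
  insideMin v x = (ℤ.- (+ v) <ᵇ x) ∧ (x <ᵇ + v)

  ascClosed : StateFn
  ascClosed k [] y x e = baseClosed lastAsc y x e
  ascClosed k (v ∷ vs) y x e =
    if belowNegMin v vs x ∨ (isEven e ∧ insideMin v x) then ascCoef k (slope y x) else 0#

  desClosed : StateFn
  desClosed k [] y x e = baseClosed lastDes y x e
  desClosed k (v ∷ vs) y x e =
    if aboveMin v vs x ∨ (isEven (e ℕ.+ k) ∧ insideMin v x) then desCoef k (slope y x) else 0#

  localTerm : (Slope → Carrier) → ℤ → ℤ → ℤ → Carrier
  localTerm Φ y x l = peakAt y x l * (valleyAt y x l * Φ (slope x l))

  localTerm-split : ∀ Φ y x l → x ≢ l →
    localTerm Φ y x l ≈ (if x <ᵇ l then valleyWeight (slope y x) * Φ up else peakWeight (slope y x) * Φ down)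
  localTerm-split Φ y x l x≢l = go (y <ᵇ x) (x <ᵇ y) (x <ᵇ l) (l <ᵇ x) <ᵇ-asym <ᵇ-asym (<ᵇ-connex x≢l)
    where
    go : ∀ y<x x<y x<l l<x → (y<x ≡ true → x<y ≡ false) → (x<l ≡ true → l<x ≡ false) → (x<l ≡ false → l<x ≡ true) →
      (if y<x ∧ l<x then p else 1#) * ((if x<y ∧ x<l then q else 1#) * Φ (if x<l then up else if l<x then down else flat))
      ≈ (if x<l then valleyWeight (if y<x then up else if x<y then down else flat) * Φ up
                else peakWeight (if y<x then up else if x<y then down else flat) * Φ down)
    go true x<y true l<x h₁ h₂ _ rewrite h₁ ≡.refl | h₂ ≡.refl = *-identityˡ _
    go true x<y false l<x h₁ _ h₃ rewrite h₁ ≡.refl | h₃ ≡.refl = *-congˡ (*-identityˡ _)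
    go false true true l<x _ h₂ _ rewrite h₂ ≡.refl = *-identityˡ _
    go false true false l<x _ _ h₃ rewrite h₃ ≡.refl = *-identityˡ _
    go false false true l<x _ h₂ _ rewrite h₂ ≡.refl = *-identityˡ _
    go false false false l<x _ _ h₃ rewrite h₃ ≡.refl = *-identityˡ _

  belowNegMin-≥ : ∀ v vs {x} → ℤ.- (+ v) ℤ.≤ x → belowNegMin v vs x ≡ false
  belowNegMin-≥ v [] h = <ᵇ-false h
  belowNegMin-≥ v (_ ∷ _) h rewrite <ᵇ-false h = ∧-zeroʳ _

  belowNegMin-≤ : ∀ v v′ vs {x} → x ℤ.≤ ℤ.- (+ v′) → belowNegMin v (v′ ∷ vs) x ≡ false
  belowNegMin-≤ v v′ vs h rewrite <ᵇ-false h = ≡.refl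

  aboveMin-≤ : ∀ v vs {x} → x ℤ.≤ + v → aboveMin v vs x ≡ false
  aboveMin-≤ v [] h = <ᵇ-false h
  aboveMin-≤ v (_ ∷ _) h rewrite <ᵇ-false h = ≡.refl

  aboveMin-≥ : ∀ v v′ vs {x} → + v′ ℤ.≤ x → aboveMin v (v′ ∷ vs) x ≡ false
  aboveMin-≥ v v′ vs h rewrite <ᵇ-false h = ∧-zeroʳ _

  insideMin-≤ : ∀ v {x} → x ℤ.≤ ℤ.- (+ v) → insideMin v x ≡ false
  insideMin-≤ v h rewrite <ᵇ-false h = ≡.refl

  insideMin-≥ : ∀ v {x} → + v ℤ.≤ x → insideMin v x ≡ false
  insideMin-≥ v h rewrite <ᵇ-false h = ∧-zeroʳ _

  insideMin-< : ∀ v {x} → ℤ.- (+ v) ℤ.< x → x ℤ.< + v → insideMin v x ≡ true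
  insideMin-< v h₁ h₂ rewrite <ᵇ-true h₁ | <ᵇ-true h₂ = ≡.refl

  extend-guard-0 : ∀ V y x l {b} t → b ≡ false → extend V y x l (if b then t else 0#) ≈ 0#
  extend-guard-0 V y x l t ≡.refl = extend-0 V y x l

  extend-guard-+ : ∀ V y x l {b b′} t → countBelow ∣ l ∣ V ≡ 0 → b ≡ b′ →
    extend V y x l (if b then t else 0#) ≈ (if b′ then peakAt y x l * (valleyAt y x l * t) else 0#)
  extend-guard-+ V y x l {b′ = b′} t rank ≡.refl = trans (extend-if V y x l b′ t) (guard b′)
    where
    guard : ∀ b → (if b then extend V y x l t else 0#) ≈ (if b then peakAt y x l * (valleyAt y x l * t) else 0#)
    guard true rewrite rank = *-identityˡ _
    guard false = refl

  extend-guard-- : ∀ V y x l {b} t → countBelow ∣ l ∣ V ≡ 1 → b ≡ true →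
    extend V y x l (if b then t else 0#) ≈ - (peakAt y x l * (valleyAt y x l * t))
  extend-guard-- V y x l t rank ≡.refl rewrite rank = -1*x≈-x _

  expandTerm-delete : ∀ F k V y x e l {V′} → delete ∣ l ∣ V ≡ V′ →
    expandTerm F k V y x e l ≡ extend V y x l (F k V′ x l (e ℕ.+ negBit l))
  expandTerm-delete F k V y x e l ≡.refl = ≡.refl

  private
    cancelˡ : ∀ x → x + (0# + - x) ≈ 0#
    cancelˡ x = trans (+-congˡ (+-identityˡ _)) (-‿inverseʳ x)

    cancelʳ : ∀ x → 0# + (x + - x) ≈ 0#
    cancelʳ x = trans (+-identityˡ _) (-‿inverseʳ x)

    dropˡ : ∀ x y → x + (0# + - y) ≈ x + - y
    dropˡ x y = +-congˡ (+-identityˡ _)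

    dropʳ : ∀ x y → 0# + (x + - y) ≈ x + - y
    dropʳ x y = +-identityˡ _

  combine-asc : ∀ a b c E X Y → (a ≡ true → b ≡ true) → (b ≡ true → c ≡ true) →
    (if E then (if c then X else Y) else 0#) + ((if not E then (if b then X else Y) else 0#) + - (if a then X else Y))
    ≈ (if (not a ∧ b) ∨ (E ∧ (not b ∧ c)) then X + - Y else 0#)
  combine-asc true true true true X Y _ _ = cancelˡ X
  combine-asc true true true false X Y _ _ = cancelʳ X
  combine-asc true false c E X Y a⇒b _ with a⇒b ≡.refl
  ... | ()
  combine-asc a true false E X Y _ b⇒c with b⇒c ≡.refl
  ... | ()
  combine-asc false true true true X Y _ _ = dropˡ X Y
  combine-asc false true true false X Y _ _ = dropʳ X Y
  combine-asc false false true true X Y _ _ = dropˡ X Y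
  combine-asc false false true false X Y _ _ = cancelʳ Y
  combine-asc false false false true X Y _ _ = cancelˡ Y
  combine-asc false false false false X Y _ _ = cancelʳ Y

  combine-des : ∀ b c d E X Y → (b ≡ true → c ≡ true) → (c ≡ true → d ≡ true) →
    (if E then (if c then X else Y) else 0#) + ((if not E then (if b then X else Y) else 0#) + - (if d then X else Y))
    ≈ (if (not c ∧ d) ∨ (not E ∧ (not b ∧ c)) then Y + - X else 0#)
  combine-des true true true true X Y _ _ = cancelˡ X
  combine-des true true true false X Y _ _ = cancelʳ X
  combine-des true false d E X Y b⇒c _ with b⇒c ≡.refl
  ... | ()
  combine-des b true false E X Y _ c⇒d with c⇒d ≡.refl
  ... | ()
  combine-des false true true true X Y _ _ = cancelˡ X
  combine-des false true true false X Y _ _ = dropʳ Y X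
  combine-des false false true true X Y _ _ = dropˡ Y X
  combine-des false false true false X Y _ _ = dropʳ Y X
  combine-des false false false true X Y _ _ = cancelˡ Y
  combine-des false false false false X Y _ _ = cancelʳ Y

  baseClosed-asc : ∀ x l e → baseClosed lastAsc x l e ≈ (if isEven e then ascCoef 0 (slope x l) else 0#)
  baseClosed-asc x l e with x <ᵇ l | l <ᵇ x | isEven e
  ... | true | _ | true = refl
  ... | true | _ | false = refl
  ... | false | true | true = refl
  ... | false | true | false = refl
  ... | false | false | true = refl
  ... | false | false | false = refl

  baseClosed-des : ∀ x l e → baseClosed lastDes x l e ≈ (if isEven e then desCoef 0 (slope x l) else 0#)
  baseClosed-des x l e with x <ᵇ l in x<l | l <ᵇ x in l<x | isEven e
  ... | true | true | _ = ⊥-elim (true≢false (≡.trans (≡.sym l<x) (<ᵇ-asym x<l)))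
  ... | true | false | true = refl
  ... | true | false | false = refl
  ... | false | true | true = refl
  ... | false | true | false = refl
  ... | false | false | true = refl
  ... | false | false | false = refl

  module AscStep (k : ℕ) (y x : ℤ) (e : ℕ) (i j : ℕ) (r : List ℕ) (i<j : i < j)
                 (v₀<r : All (suc i <_) r) (v₁<r : All (suc j <_) r) where
    V : List ℕ
    V = suc i ∷ suc j ∷ r

    T : ℤ → Carrier
    T = expandTerm ascClosed k V y x e

    L : ℤ → Carrier
    L = localTerm (ascCoef k) y x

    term-v₀ : T (+ suc i) ≈ (if isEven e then L (+ suc i) else 0#)
    term-v₀ = trans (reflexive (expandTerm-delete ascClosed k V y x e (+ suc i) (delete-head (suc i) (suc j ∷ r))))
                    (extend-guard-+ V y x (+ suc i) _ (countBelow-head (s≤s i<j ∷ v₀<r)) window)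
      where
      window : belowNegMin (suc j) r (+ suc i) ∨ (isEven (e ℕ.+ 0) ∧ insideMin (suc j) (+ suc i)) ≡ isEven e
      window rewrite belowNegMin-≥ (suc j) r {+ suc i} ℤ.-≤+ | insideMin-< (suc j) ℤ.-<+ (ℤ.+<+ (s≤s i<j))
                   | ℕₚ.+-identityʳ e = ∧-identityʳ _

    term-v₀′ : T -[1+ i ] ≈ (if not (isEven e) then L -[1+ i ] else 0#)
    term-v₀′ = trans (reflexive (expandTerm-delete ascClosed k V y x e -[1+ i ] (delete-head (suc i) (suc j ∷ r))))
                     (extend-guard-+ V y x -[1+ i ] _ (countBelow-head (s≤s i<j ∷ v₀<r)) window)
      where
      window : belowNegMin (suc j) r -[1+ i ] ∨ (isEven (e ℕ.+ 1) ∧ insideMin (suc j) -[1+ i ]) ≡ not (isEven e)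
      window rewrite belowNegMin-≥ (suc j) r (ℤ.-≤- (ℕₚ.<⇒≤ i<j)) | insideMin-< (suc j) (ℤ.-<- i<j) ℤ.-<+
                   | isEven-+1 e = ∧-identityʳ _

    term-v₁ : T (+ suc j) ≈ 0#
    term-v₁ = trans (reflexive (expandTerm-delete ascClosed k V y x e (+ suc j) (delete-second r (s≤s i<j))))
                    (extend-guard-0 V y x (+ suc j) _ window)
      where
      window : belowNegMin (suc i) r (+ suc j) ∨ (isEven (e ℕ.+ 0) ∧ insideMin (suc i) (+ suc j)) ≡ false
      window rewrite belowNegMin-≥ (suc i) r {+ suc j} ℤ.-≤+ | insideMin-≥ (suc i) (ℤ.+≤+ (s≤s (ℕₚ.<⇒≤ i<j))) =
        ∧-zeroʳ _

    term-v₁′ : T -[1+ j ] ≈ - L -[1+ j ]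
    term-v₁′ = trans (reflexive (expandTerm-delete ascClosed k V y x e -[1+ j ] (delete-second r (s≤s i<j))))
                     (extend-guard-- V y x -[1+ j ] _ (countBelow-second (s≤s i<j) v₁<r) window)
      where
      next : ∀ {r} → All (suc j <_) r → belowNegMin (suc i) r -[1+ j ] ≡ true
      next [] = <ᵇ-true (ℤ.-<- i<j)
      next (s≤s j<m ∷ _) = ≡.cong₂ _∧_ (<ᵇ-true (ℤ.-<- j<m)) (<ᵇ-true (ℤ.-<- i<j))
      window : belowNegMin (suc i) r -[1+ j ] ∨ (isEven (e ℕ.+ 1) ∧ insideMin (suc i) -[1+ j ]) ≡ true
      window rewrite next v₁<r = ≡.refl

    term-later : ∀ a → suc j < a → T (+ a) + T (ℤ.- (+ a)) ≈ 0#
    term-later (suc m) (s≤s j<m) = trans (+-cong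
        (trans (reflexive (expandTerm-delete ascClosed k V y x e (+ suc m) later))
               (extend-guard-0 V y x (+ suc m) _ window₊))
        (trans (reflexive (expandTerm-delete ascClosed k V y x e -[1+ m ] later))
               (extend-guard-0 V y x -[1+ m ] _ window₋)))
      (+-identityˡ 0#)
      where
      i<m = ℕₚ.<-trans i<j j<m
      later = delete-later r (s≤s i<m) (s≤s j<m)
      window₊ : belowNegMin (suc i) (suc j ∷ delete (suc m) r) (+ suc m)
                ∨ (isEven (e ℕ.+ 0) ∧ insideMin (suc i) (+ suc m)) ≡ false
      window₊ rewrite belowNegMin-≥ (suc i) (suc j ∷ delete (suc m) r) {+ suc m} ℤ.-≤+
                    | insideMin-≥ (suc i) (ℤ.+≤+ (s≤s (ℕₚ.<⇒≤ i<m))) = ∧-zeroʳ _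
      window₋ : belowNegMin (suc i) (suc j ∷ delete (suc m) r) -[1+ m ]
                ∨ (isEven (e ℕ.+ 1) ∧ insideMin (suc i) -[1+ m ]) ≡ false
      window₋ rewrite belowNegMin-≤ (suc i) (suc j) (delete (suc m) r) (ℤ.-≤- (ℕₚ.<⇒≤ j<m))
                    | insideMin-≤ (suc i) (ℤ.-≤- (ℕₚ.<⇒≤ i<m)) = ∧-zeroʳ _

    step : ∣ x ∣ ∈ᵇ V ≡ false → expand ascClosed k V y x e ≈ ascClosed (suc k) V y x e
    step x∉V = begin
      (T (+ suc i) + T -[1+ i ]) + ((T (+ suc j) + T -[1+ j ]) + Σ (λ a → T (+ a) + T (ℤ.- (+ a))) r)
        ≈⟨ +-cong (+-cong term-v₀ term-v₀′) (+-cong (+-cong term-v₁ term-v₁′)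
                                                   (trans (Σ-cong-All v₁<r term-later) (Σ-0 r))) ⟩
      ((if E then L (+ suc i) else 0#) + (if not E then L -[1+ i ] else 0#)) + ((0# + - L -[1+ j ]) + 0#)
        ≈⟨ trans (+-congˡ (trans (+-identityʳ _) (+-identityˡ _))) (+-assoc _ _ _) ⟩
      (if E then L (+ suc i) else 0#) + ((if not E then L -[1+ i ] else 0#) + - L -[1+ j ])
        ≈⟨ +-cong (guard-cong E (localTerm-split (ascCoef k) y x (+ suc i) (proj₁ x≢v₀)))
                  (+-cong (guard-cong (not E) (localTerm-split (ascCoef k) y x -[1+ i ] (proj₂ x≢v₀)))
                          (-‿cong (localTerm-split (ascCoef k) y x -[1+ j ] (proj₂ x≢v₁)))) ⟩
      (if E then (if x<v₀ then X else Y) else 0#)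
        + ((if not E then (if x<-v₀ then X else Y) else 0#) + - (if x<-v₁ then X else Y))
        ≈⟨ combine-asc x<-v₁ x<-v₀ x<v₀ E X Y (λ h → <ᵇ-trans h (<ᵇ-true (ℤ.-<- i<j)))
                                             (λ h → <ᵇ-trans {z = + suc i} h ≡.refl) ⟩
      (if (not x<-v₁ ∧ x<-v₀) ∨ (E ∧ (not x<-v₀ ∧ x<v₀)) then X + - Y else 0#)
        ≡⟨ ≡.cong₂ (λ u w → if (u ∧ x<-v₀) ∨ (E ∧ (w ∧ x<v₀)) then X + - Y else 0#)
                   (≡.sym (<ᵇ-flip (proj₂ x≢v₁))) (≡.sym (<ᵇ-flip (proj₂ x≢v₀))) ⟩
      ascClosed (suc k) V y x e ∎
      where
      E = isEven e
      x<-v₁ = x <ᵇ -[1+ j ]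
      x<-v₀ = x <ᵇ -[1+ i ]
      x<v₀ = x <ᵇ + suc i
      X = valleyWeight (slope y x) * ascCoef k up
      Y = peakWeight (slope y x) * ascCoef k down
      x≢v₀ = ≢-signed (∉ᵇ-head (suc j ∷ r) x∉V)
      x≢v₁ = ≢-signed (∉ᵇ-head r (∉ᵇ-tail (suc j ∷ r) x∉V))

  module AscStepOne (y x : ℤ) (e i : ℕ) where
    V : List ℕ
    V = suc i ∷ []

    T : ℤ → Carrier
    T = expandTerm ascClosed 0 V y x e

    L : ℤ → Carrier
    L = localTerm (ascCoef 0) y x

    term : ∀ l {E} → delete ∣ l ∣ V ≡ [] → countBelow ∣ l ∣ V ≡ 0 → isEven (e ℕ.+ negBit l) ≡ E →
      T l ≈ (if E then L l else 0#)
    term l del rank parity = begin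
      T l                                                        ≡⟨ expandTerm-delete ascClosed 0 V y x e l del ⟩
      extend V y x l (baseClosed lastAsc x l (e ℕ.+ negBit l))    ≈⟨ extend-cong V y x l (baseClosed-asc x l (e ℕ.+ negBit l)) ⟩
      extend V y x l (if isEven (e ℕ.+ negBit l) then ascCoef 0 (slope x l) else 0#)
        ≈⟨ extend-guard-+ V y x l _ rank parity ⟩
      (if _ then L l else 0#) ∎

    step : ∣ x ∣ ∈ᵇ V ≡ false → expand ascClosed 0 V y x e ≈ ascClosed 1 V y x e
    step x∉V = begin
      (T (+ suc i) + T -[1+ i ]) + 0#
        ≈⟨ +-identityʳ _ ⟩
      T (+ suc i) + T -[1+ i ]
        ≈⟨ +-cong (term (+ suc i) (delete-head (suc i) []) (countBelow-head []) (≡.cong isEven (ℕₚ.+-identityʳ e)))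
                  (term -[1+ i ] (delete-head (suc i) []) (countBelow-head []) (isEven-+1 e)) ⟩
      (if E then L (+ suc i) else 0#) + (if not E then L -[1+ i ] else 0#)
        ≈⟨ +-congˡ (trans (+-congˡ (trans (-‿cong (zeroʳ _)) -0#≈0#)) (+-identityʳ _)) ⟨
      (if E then L (+ suc i) else 0#) + ((if not E then L -[1+ i ] else 0#) + - Y)
        ≈⟨ +-cong (guard-cong E (localTerm-split (ascCoef 0) y x (+ suc i) (proj₁ x≢v)))
                  (+-congʳ (guard-cong (not E) (localTerm-split (ascCoef 0) y x -[1+ i ] (proj₂ x≢v)))) ⟩
      (if E then (if x<v then X else Y) else 0#) + ((if not E then (if x<-v then X else Y) else 0#) + - (if false then X else Y))
        ≈⟨ combine-asc false x<-v x<v E X Y (λ ()) (λ h → <ᵇ-trans {z = + suc i} h ≡.refl) ⟩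
      (if x<-v ∨ (E ∧ (not x<-v ∧ x<v)) then X + - Y else 0#)
        ≡⟨ ≡.cong (λ u → if x<-v ∨ (E ∧ (u ∧ x<v)) then X + - Y else 0#) (≡.sym (<ᵇ-flip (proj₂ x≢v))) ⟩
      ascClosed 1 V y x e ∎
      where
      E = isEven e
      x<-v = x <ᵇ -[1+ i ]
      x<v = x <ᵇ + suc i
      X = valleyWeight (slope y x) * ascCoef 0 up
      Y = peakWeight (slope y x) * ascCoef 0 down
      x≢v = ≢-signed (∉ᵇ-head [] x∉V)

  ascClosed-step : ∀ k V y x e → Sorted V → All (0 <_) V → length V ≡ suc k → ∣ x ∣ ∈ᵇ V ≡ false →
    expand ascClosed k V y x e ≈ ascClosed (suc k) V y x e
  ascClosed-step k [] y x e _ _ () _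
  ascClosed-step k (zero ∷ _) y x e _ (() ∷ _) _ _
  ascClosed-step zero (suc i ∷ []) y x e _ _ _ x∉V = AscStepOne.step y x e i x∉V
  ascClosed-step k (suc i ∷ zero ∷ _) y x e ((() ∷ _) ∷ _) _ _ _
  ascClosed-step k (suc i ∷ suc j ∷ r) y x e ((s≤s i<j ∷ v₀<r) ∷ v₁<r ∷ _) _ _ x∉V =
    AscStep.step k y x e i j r i<j v₀<r v₁<r x∉V

  module DesStep (k : ℕ) (y x : ℤ) (e : ℕ) (i j : ℕ) (r : List ℕ) (i<j : i < j)
                 (v₀<r : All (suc i <_) r) (v₁<r : All (suc j <_) r) where
    V : List ℕ
    V = suc i ∷ suc j ∷ r

    T : ℤ → Carrier
    T = expandTerm desClosed k V y x e

    L : ℤ → Carrier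
    L = localTerm (desCoef k) y x

    term-v₀ : T (+ suc i) ≈ (if isEven (e ℕ.+ k) then L (+ suc i) else 0#)
    term-v₀ = trans (reflexive (expandTerm-delete desClosed k V y x e (+ suc i) (delete-head (suc i) (suc j ∷ r))))
                    (extend-guard-+ V y x (+ suc i) _ (countBelow-head (s≤s i<j ∷ v₀<r)) window)
      where
      window : aboveMin (suc j) r (+ suc i) ∨ (isEven (e ℕ.+ 0 ℕ.+ k) ∧ insideMin (suc j) (+ suc i)) ≡ isEven (e ℕ.+ k)
      window rewrite aboveMin-≤ (suc j) r (ℤ.+≤+ (s≤s (ℕₚ.<⇒≤ i<j))) | insideMin-< (suc j) ℤ.-<+ (ℤ.+<+ (s≤s i<j))
                   | ℕₚ.+-identityʳ e = ∧-identityʳ _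

    term-v₀′ : T -[1+ i ] ≈ (if not (isEven (e ℕ.+ k)) then L -[1+ i ] else 0#)
    term-v₀′ = trans (reflexive (expandTerm-delete desClosed k V y x e -[1+ i ] (delete-head (suc i) (suc j ∷ r))))
                     (extend-guard-+ V y x -[1+ i ] _ (countBelow-head (s≤s i<j ∷ v₀<r)) window)
      where
      window : aboveMin (suc j) r -[1+ i ] ∨ (isEven (e ℕ.+ 1 ℕ.+ k) ∧ insideMin (suc j) -[1+ i ]) ≡ not (isEven (e ℕ.+ k))
      window rewrite aboveMin-≤ (suc j) r { -[1+ i ]} ℤ.-≤+ | insideMin-< (suc j) (ℤ.-<- i<j) ℤ.-<+
                   | isEven-+1+ e k = ∧-identityʳ _

    term-v₁ : T (+ suc j) ≈ - L (+ suc j)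
    term-v₁ = trans (reflexive (expandTerm-delete desClosed k V y x e (+ suc j) (delete-second r (s≤s i<j))))
                    (extend-guard-- V y x (+ suc j) _ (countBelow-second (s≤s i<j) v₁<r) window)
      where
      next : ∀ {r} → All (suc j <_) r → aboveMin (suc i) r (+ suc j) ≡ true
      next [] = <ᵇ-true (ℤ.+<+ (s≤s i<j))
      next (s≤s j<m ∷ _) = ≡.cong₂ _∧_ (<ᵇ-true (ℤ.+<+ (s≤s i<j))) (<ᵇ-true (ℤ.+<+ (s≤s j<m)))
      window : aboveMin (suc i) r (+ suc j) ∨ (isEven (e ℕ.+ 0 ℕ.+ k) ∧ insideMin (suc i) (+ suc j)) ≡ true
      window rewrite next v₁<r = ≡.refl

    term-v₁′ : T -[1+ j ] ≈ 0#
    term-v₁′ = trans (reflexive (expandTerm-delete desClosed k V y x e -[1+ j ] (delete-second r (s≤s i<j))))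
                     (extend-guard-0 V y x -[1+ j ] _ window)
      where
      window : aboveMin (suc i) r -[1+ j ] ∨ (isEven (e ℕ.+ 1 ℕ.+ k) ∧ insideMin (suc i) -[1+ j ]) ≡ false
      window rewrite aboveMin-≤ (suc i) r { -[1+ j ]} ℤ.-≤+ | insideMin-≤ (suc i) (ℤ.-≤- (ℕₚ.<⇒≤ i<j)) = ∧-zeroʳ _

    term-later : ∀ a → suc j < a → T (+ a) + T (ℤ.- (+ a)) ≈ 0#
    term-later (suc m) (s≤s j<m) = trans (+-cong
        (trans (reflexive (expandTerm-delete desClosed k V y x e (+ suc m) later))
               (extend-guard-0 V y x (+ suc m) _ window₊))
        (trans (reflexive (expandTerm-delete desClosed k V y x e -[1+ m ] later))
               (extend-guard-0 V y x -[1+ m ] _ window₋)))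
      (+-identityˡ 0#)
      where
      i<m = ℕₚ.<-trans i<j j<m
      later = delete-later r (s≤s i<m) (s≤s j<m)
      window₊ : aboveMin (suc i) (suc j ∷ delete (suc m) r) (+ suc m)
                ∨ (isEven (e ℕ.+ 0 ℕ.+ k) ∧ insideMin (suc i) (+ suc m)) ≡ false
      window₊ rewrite aboveMin-≥ (suc i) (suc j) (delete (suc m) r) (ℤ.+≤+ (s≤s (ℕₚ.<⇒≤ j<m)))
                    | insideMin-≥ (suc i) (ℤ.+≤+ (s≤s (ℕₚ.<⇒≤ i<m))) = ∧-zeroʳ _
      window₋ : aboveMin (suc i) (suc j ∷ delete (suc m) r) -[1+ m ]
                ∨ (isEven (e ℕ.+ 1 ℕ.+ k) ∧ insideMin (suc i) -[1+ m ]) ≡ false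
      window₋ rewrite aboveMin-≤ (suc i) (suc j ∷ delete (suc m) r) { -[1+ m ]} ℤ.-≤+
                    | insideMin-≤ (suc i) (ℤ.-≤- (ℕₚ.<⇒≤ i<m)) = ∧-zeroʳ _

    step : ∣ x ∣ ∈ᵇ V ≡ false → expand desClosed k V y x e ≈ desClosed (suc k) V y x e
    step x∉V = begin
      (T (+ suc i) + T -[1+ i ]) + ((T (+ suc j) + T -[1+ j ]) + Σ (λ a → T (+ a) + T (ℤ.- (+ a))) r)
        ≈⟨ +-cong (+-cong term-v₀ term-v₀′) (+-cong (+-cong term-v₁ term-v₁′)
                                                   (trans (Σ-cong-All v₁<r term-later) (Σ-0 r))) ⟩
      ((if E then L (+ suc i) else 0#) + (if not E then L -[1+ i ] else 0#)) + ((- L (+ suc j) + 0#) + 0#)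
        ≈⟨ trans (+-congˡ (trans (+-identityʳ _) (+-identityʳ _))) (+-assoc _ _ _) ⟩
      (if E then L (+ suc i) else 0#) + ((if not E then L -[1+ i ] else 0#) + - L (+ suc j))
        ≈⟨ +-cong (guard-cong E (localTerm-split (desCoef k) y x (+ suc i) (proj₁ x≢v₀)))
                  (+-cong (guard-cong (not E) (localTerm-split (desCoef k) y x -[1+ i ] (proj₂ x≢v₀)))
                          (-‿cong (localTerm-split (desCoef k) y x (+ suc j) (proj₁ x≢v₁)))) ⟩
      (if E then (if x<v₀ then X else Y) else 0#)
        + ((if not E then (if x<-v₀ then X else Y) else 0#) + - (if x<v₁ then X else Y))
        ≈⟨ combine-des x<-v₀ x<v₀ x<v₁ E X Y (λ h → <ᵇ-trans {z = + suc i} h ≡.refl)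
                                           (λ h → <ᵇ-trans h (<ᵇ-true (ℤ.+<+ (s≤s i<j)))) ⟩
      (if (not x<v₀ ∧ x<v₁) ∨ (not E ∧ (not x<-v₀ ∧ x<v₀)) then Y + - X else 0#)
        ≡⟨ ≡.cong₂ (λ u w → if (u ∧ x<v₁) ∨ w then Y + - X else 0#)
                   (≡.sym (<ᵇ-flip (proj₁ x≢v₀)))
                   (≡.cong₂ _∧_ (≡.sym (isEven-+suc e k)) (≡.cong (_∧ x<v₀) (≡.sym (<ᵇ-flip (proj₂ x≢v₀))))) ⟩
      desClosed (suc k) V y x e ∎
      where
      E = isEven (e ℕ.+ k)
      x<-v₀ = x <ᵇ -[1+ i ]
      x<v₀ = x <ᵇ + suc i
      x<v₁ = x <ᵇ + suc j
      X = valleyWeight (slope y x) * desCoef k up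
      Y = peakWeight (slope y x) * desCoef k down
      x≢v₀ = ≢-signed (∉ᵇ-head (suc j ∷ r) x∉V)
      x≢v₁ = ≢-signed (∉ᵇ-head r (∉ᵇ-tail (suc j ∷ r) x∉V))

  module DesStepOne (y x : ℤ) (e i : ℕ) where
    V : List ℕ
    V = suc i ∷ []

    T : ℤ → Carrier
    T = expandTerm desClosed 0 V y x e

    L : ℤ → Carrier
    L = localTerm (desCoef 0) y x

    term : ∀ l {E} → delete ∣ l ∣ V ≡ [] → countBelow ∣ l ∣ V ≡ 0 → isEven (e ℕ.+ negBit l) ≡ E →
      T l ≈ (if E then L l else 0#)
    term l del rank parity = begin
      T l                                                        ≡⟨ expandTerm-delete desClosed 0 V y x e l del ⟩
      extend V y x l (baseClosed lastDes x l (e ℕ.+ negBit l))    ≈⟨ extend-cong V y x l (baseClosed-des x l (e ℕ.+ negBit l)) ⟩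
      extend V y x l (if isEven (e ℕ.+ negBit l) then desCoef 0 (slope x l) else 0#)
        ≈⟨ extend-guard-+ V y x l _ rank parity ⟩
      (if _ then L l else 0#) ∎

    step : ∣ x ∣ ∈ᵇ V ≡ false → expand desClosed 0 V y x e ≈ desClosed 1 V y x e
    step x∉V = begin
      (T (+ suc i) + T -[1+ i ]) + 0#
        ≈⟨ +-identityʳ _ ⟩
      T (+ suc i) + T -[1+ i ]
        ≈⟨ +-cong (term (+ suc i) (delete-head (suc i) []) (countBelow-head []) (≡.cong isEven (ℕₚ.+-identityʳ e)))
                  (term -[1+ i ] (delete-head (suc i) []) (countBelow-head []) (isEven-+1 e)) ⟩
      (if E then L (+ suc i) else 0#) + (if not E then L -[1+ i ] else 0#)
        ≈⟨ +-congˡ (trans (+-congˡ (trans (-‿cong (zeroʳ _)) -0#≈0#)) (+-identityʳ _)) ⟨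
      (if E then L (+ suc i) else 0#) + ((if not E then L -[1+ i ] else 0#) + - X)
        ≈⟨ +-cong (guard-cong E (localTerm-split (desCoef 0) y x (+ suc i) (proj₁ x≢v)))
                  (+-congʳ (guard-cong (not E) (localTerm-split (desCoef 0) y x -[1+ i ] (proj₂ x≢v)))) ⟩
      (if E then (if x<v then X else Y) else 0#) + ((if not E then (if x<-v then X else Y) else 0#) + - (if true then X else Y))
        ≈⟨ combine-des x<-v x<v true E X Y (λ h → <ᵇ-trans {z = + suc i} h ≡.refl) (λ _ → ≡.refl) ⟩
      (if (not x<v ∧ true) ∨ (not E ∧ (not x<-v ∧ x<v)) then Y + - X else 0#)
        ≡⟨ ≡.cong₂ (λ u w → if u ∨ w then Y + - X else 0#)
                   (≡.trans (∧-identityʳ _) (≡.sym (<ᵇ-flip (proj₁ x≢v))))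
                   (≡.cong₂ _∧_ (≡.sym (isEven-+1 e)) (≡.cong (_∧ x<v) (≡.sym (<ᵇ-flip (proj₂ x≢v))))) ⟩
      desClosed 1 V y x e ∎
      where
      E = isEven e
      x<-v = x <ᵇ -[1+ i ]
      x<v = x <ᵇ + suc i
      X = valleyWeight (slope y x) * desCoef 0 up
      Y = peakWeight (slope y x) * desCoef 0 down
      x≢v = ≢-signed (∉ᵇ-head [] x∉V)

  desClosed-step : ∀ k V y x e → Sorted V → All (0 <_) V → length V ≡ suc k → ∣ x ∣ ∈ᵇ V ≡ false →
    expand desClosed k V y x e ≈ desClosed (suc k) V y x e
  desClosed-step k [] y x e _ _ () _
  desClosed-step k (zero ∷ _) y x e _ (() ∷ _) _ _
  desClosed-step zero (suc i ∷ []) y x e _ _ _ x∉V = DesStepOne.step y x e i x∉V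
  desClosed-step k (suc i ∷ zero ∷ _) y x e ((() ∷ _) ∷ _) _ _ _
  desClosed-step k (suc i ∷ suc j ∷ r) y x e ((s≤s i<j ∷ v₀<r) ∷ v₁<r ∷ _) _ _ x∉V =
    DesStep.step k y x e i j r i<j v₀<r v₁<r x∉V

module Symmetry {c ℓ} (R : CommutativeRing c ℓ) (p q : CommutativeRing.Carrier R) where
  open CommutativeRing R
  open RingEval R
  open Coefficients R p q
  module Swapped = Coefficients R q p

  desCoef-swap : ∀ k s → desCoef k s ≈ Swapped.ascCoef k (reverse s)
  desCoef-swap zero up = refl
  desCoef-swap zero down = refl
  desCoef-swap zero flat = refl
  desCoef-swap (suc k) up = +-cong (*-congˡ (desCoef-swap k down)) (-‿cong (*-congˡ (desCoef-swap k up)))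
  desCoef-swap (suc k) down = +-cong (*-congˡ (desCoef-swap k down)) (-‿cong (*-congˡ (desCoef-swap k up)))
  desCoef-swap (suc k) flat = +-cong (*-congˡ (desCoef-swap k down)) (-‿cong (*-congˡ (desCoef-swap k up)))

  pow-cong : ∀ {x y} k → x ≈ y → pow x k ≈ pow y k
  pow-cong zero _ = refl
  pow-cong (suc k) x≈y = *-cong x≈y (pow-cong k x≈y)

  desCoef-flat-even : ∀ m → desCoef (suc (suc (m ℕ.+ m))) flat ≈ oneMinus p * pow (oneMinus (p * q)) m
  desCoef-flat-even m =
    trans (desCoef-swap (suc (suc (m ℕ.+ m))) flat)
      (trans (Swapped.ascCoef-flat-even m) (*-congˡ (pow-cong m (+-congˡ (-‿cong (*-comm q p))))))

module InitialState {c ℓ} (R : CommutativeRing c ℓ) (p q : CommutativeRing.Carrier R) where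
  open CommutativeRing R
  open RingEval R
  open ListSum R
  open Extension R p q
  open Coefficients R p q
  open ClosedForms R p q
  open import Relation.Binary.Reasoning.Setoid setoid

  -- The initial state repeats π₀ = 0, which creates no peak, valley, ascent or descent.
  weightFrom-origin : ∀ w → weightFrom (+ 0) (+ 0) w ≡ weight p q w
  weightFrom-origin [] = ≡.refl
  weightFrom-origin (_ ∷ _) = ≡.refl

  module _ (n : ℕ) where
    open Expansion R n p q

    ⊆ᵇ-letters : ∀ {w} → All Letter w → map ∣_∣ w ⊆ᵇ countFrom 1 n ≡ true
    ⊆ᵇ-letters [] = ≡.refl
    ⊆ᵇ-letters ((0<l , l≤n) ∷ ls) rewrite ∈ᵇ-countFrom 1 n 0<l (s≤s l≤n) = ⊆ᵇ-letters ls

    letterSet-bounded : Bounded (countFrom 1 n)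
    letterSet-bounded = All.zip (countFrom-above 1 n (s≤s z≤n) , countFrom-bounded 1 n ℕₚ.≤-refl)

    signedSum≈tailSum : ∀ md → (∀ w → md (+ 0 ∷ + 0 ∷ w) ≡ md (+ 0 ∷ w)) →
      sumW p q (filter (λ w → md (+ 0 ∷ w) ≟ᵇ true) (Dn n)) ≈ tailSum md n (countFrom 1 n) (+ 0) (+ 0) 0
    signedSum≈tailSum md origin = begin
      Σ (weight p q) (filter (λ w → md (+ 0 ∷ w) ≟ᵇ true) (Dn n))   ≈⟨ Σ-if (λ w → md (+ 0 ∷ w)) _ (Dn n) ⟩
      Σ (λ w → if md (+ 0 ∷ w) then weight p q w else 0#) (Dn n)     ≈⟨ Σ-if isD _ (words n n) ⟩
      Σ (λ w → if isD w then (if md (+ 0 ∷ w) then weight p q w else 0#) else 0#) (words n n)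
        ≈⟨ Σ-words-cong n term ⟩
      tailSum md n (countFrom 1 n) (+ 0) (+ 0) 0 ∎
      where
      merge : ∀ m d ev (W : Carrier) →
        (if d ∧ ev then (if m then W else 0#) else 0#) ≈ (if m ∧ (d ∧ (true ∧ ev)) then W else 0#)
      merge true true true W = refl
      merge true true false W = refl
      merge true false ev W = refl
      merge false true true W = refl
      merge false true false W = refl
      merge false false ev W = refl
      term : ∀ w → length w ≡ n → All Letter w →
        (if isD w then (if md (+ 0 ∷ w) then weight p q w else 0#) else 0#) ≈ tailTerm md (countFrom 1 n) (+ 0) (+ 0) 0 w
      term w _ ls rewrite origin w | weightFrom-origin w | ⊆ᵇ-letters ls =
        merge (md (+ 0 ∷ w)) (distinct (map ∣_∣ w)) (isEven (negCount w)) _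

    SgnDAltrun-a≈ascClosed : SgnDAltrun-a n p q ≈ ascClosed n (countFrom 1 n) (+ 0) (+ 0) 0
    SgnDAltrun-a≈ascClosed = trans (signedSum≈tailSum lastAsc lastAsc-origin)
      (tailSum-closed {lastAsc} (λ _ _ _ _ → ≡.refl) ascClosed (λ _ _ _ → refl) ascClosed-step
        n (Sorted-countFrom 1 n) letterSet-bounded (length-countFrom 1 n) (+ 0) (+ 0) 0
        (∉ᵇ-above (All.map proj₁ letterSet-bounded)))
      where
      lastAsc-origin : ∀ w → lastAsc (+ 0 ∷ + 0 ∷ w) ≡ lastAsc (+ 0 ∷ w)
      lastAsc-origin [] = ≡.refl
      lastAsc-origin (_ ∷ _) = ≡.refl

    SgnDAltrun-d≈desClosed : SgnDAltrun-d n p q ≈ desClosed n (countFrom 1 n) (+ 0) (+ 0) 0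
    SgnDAltrun-d≈desClosed = trans (signedSum≈tailSum lastDes lastDes-origin)
      (tailSum-closed {lastDes} (λ _ _ _ _ → ≡.refl) desClosed (λ _ _ _ → refl) desClosed-step
        n (Sorted-countFrom 1 n) letterSet-bounded (length-countFrom 1 n) (+ 0) (+ 0) 0
        (∉ᵇ-above (All.map proj₁ letterSet-bounded)))
      where
      lastDes-origin : ∀ w → lastDes (+ 0 ∷ + 0 ∷ w) ≡ lastDes (+ 0 ∷ w)
      lastDes-origin [] = ≡.refl
      lastDes-origin (_ ∷ _) = ≡.refl

  ascClosed-origin : ∀ n → ascClosed (suc n) (countFrom 1 (suc n)) (+ 0) (+ 0) 0 ≡ ascCoef (suc n) flat
  ascClosed-origin zero = ≡.refl
  ascClosed-origin (suc n) = ≡.refl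

  desClosed-origin : ∀ n → desClosed (suc n) (countFrom 1 (suc n)) (+ 0) (+ 0) 0 ≡
                           (if isEven (suc n) then desCoef (suc n) flat else 0#)
  desClosed-origin zero = ≡.refl
  desClosed-origin (suc n) rewrite ∧-identityʳ (isEven n) = ≡.refl

  SgnDAltrun-a≈ascCoef : ∀ n → SgnDAltrun-a (suc n) p q ≈ ascCoef (suc n) flat
  SgnDAltrun-a≈ascCoef n = trans (SgnDAltrun-a≈ascClosed (suc n)) (reflexive (ascClosed-origin n))

  SgnDAltrun-d≈desCoef : ∀ n → SgnDAltrun-d (suc n) p q ≈ (if isEven (suc n) then desCoef (suc n) flat else 0#)
  SgnDAltrun-d≈desCoef n = trans (SgnDAltrun-d≈desClosed (suc n)) (reflexive (desClosed-origin n))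

twice-suc : ∀ m → 2 ℕ.* suc m ≡ suc (suc (m ℕ.+ m))
twice-suc m = ≡.cong suc (≡.trans (≡.cong (m ℕ.+_) (ℕₚ.+-identityʳ (suc m))) (ℕₚ.+-suc m m))

twice-+1 : ∀ k → 2 ℕ.* k ℕ.+ 1 ≡ suc (k ℕ.+ k)
twice-+1 k = ≡.trans (ℕₚ.+-comm (2 ℕ.* k) 1) (≡.cong (λ t → suc (k ℕ.+ t)) (ℕₚ.+-identityʳ k))

theorem48 : {c ℓ : Level} (R : CommutativeRing c ℓ) →
    let open CommutativeRing R in
    let open RingEval R in
    (p q : Carrier) →
      ((m : ℕ) →
        (SgnDAltrun-a (2 ℕ.* suc m) p q ≈ oneMinus q * pow (oneMinus (p * q)) m)
        × (SgnDAltrun-d (2 ℕ.* suc m) p q ≈ oneMinus p * pow (oneMinus (p * q)) m))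
      × ((k : ℕ) →
        (SgnDAltrun-a (2 ℕ.* k ℕ.+ 1) p q ≈ pow (oneMinus (p * q)) k)
        × (SgnDAltrun-d (2 ℕ.* k ℕ.+ 1) p q ≈ 0#))
theorem48 R p q = (λ m → even-a m , even-d m) , (λ k → odd-a k , odd-d k)
  where
  open CommutativeRing R
  open RingEval R
  open Coefficients R p q
  open Symmetry R p q
  open InitialState R p q

  reindex : ∀ {N M} (F : ℕ → Carrier) {x} → N ≡ M → F M ≈ x → F N ≈ x
  reindex F ≡.refl h = h

  even-a : ∀ m → SgnDAltrun-a (2 ℕ.* suc m) p q ≈ oneMinus q * pow (oneMinus (p * q)) m
  even-a m = reindex (λ N → SgnDAltrun-a N p q) (twice-suc m)
    (trans (SgnDAltrun-a≈ascCoef (suc (m ℕ.+ m))) (ascCoef-flat-even m))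

  even-d : ∀ m → SgnDAltrun-d (2 ℕ.* suc m) p q ≈ oneMinus p * pow (oneMinus (p * q)) m
  even-d m = reindex (λ N → SgnDAltrun-d N p q) (twice-suc m) (begin
    SgnDAltrun-d (suc (suc (m ℕ.+ m))) p q                                ≈⟨ SgnDAltrun-d≈desCoef (suc (m ℕ.+ m)) ⟩
    (if isEven (m ℕ.+ m) then desCoef (suc (suc (m ℕ.+ m))) flat else 0#)
      ≡⟨ ≡.cong (λ b → if b then desCoef (suc (suc (m ℕ.+ m))) flat else 0#) (isEven-double m) ⟩
    desCoef (suc (suc (m ℕ.+ m))) flat                                    ≈⟨ desCoef-flat-even m ⟩
    oneMinus p * pow (oneMinus (p * q)) m ∎)
    where open import Relation.Binary.Reasoning.Setoid setoid

  odd-a : ∀ k → SgnDAltrun-a (2 ℕ.* k ℕ.+ 1) p q ≈ pow (oneMinus (p * q)) k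
  odd-a k = reindex (λ N → SgnDAltrun-a N p q) (twice-+1 k)
    (trans (SgnDAltrun-a≈ascCoef (k ℕ.+ k)) (ascCoef-flat-odd k))

  odd-d : ∀ k → SgnDAltrun-d (2 ℕ.* k ℕ.+ 1) p q ≈ 0#
  odd-d k = reindex (λ N → SgnDAltrun-d N p q) (twice-+1 k) (trans (SgnDAltrun-d≈desCoef (k ℕ.+ k))
    (reflexive (≡.cong (λ b → if b then desCoef (suc (k ℕ.+ k)) flat else 0#)
                       (≡.trans (isEven-suc (k ℕ.+ k)) (≡.cong not (isEven-double k))))))
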